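{- Let $X,Y$ be lower Eulerian posets with rank functions $\rho_X,\rho_Y$, $\sigma:X\to Y$ a strong formal subdivision with associated poset $\Gamma$, $r_\Gamma\in I(\Gamma)$ a weak rank function and $\kappa_\Gamma\in\mathcal{I}(\Gamma)\cap U(\Gamma)$ multiplicative and rank alternating (as in the context). Then \[ f_\Gamma|_{X/Y}=-f_\Gamma\cdot\Delta\widehat{\ell_\sigma}=-f_\Gamma|_X\cdot\Delta\widehat{\ell_\sigma}.\] That is, for all $x\in X$, $y\in Y$ with $\sigma(x)\le y$, \[ f_\Gamma(x,y)=\sum_{x\le x'\in X,\ \sigma(x')\le y}(-1)^{\rho_Y(y)-\rho_X(x')}f_X(x,x')\,\Delta\ell_\sigma(x',y).\]
   Context: All posets are finite. For a poset $B$, $I(B)$ is the set of functions $p$ from closed intervals $[z,z']$ of $B$ to $\mathbb{Z}[t]$, a $\mathbb{Z}[t]$-algebra with pointwise sum and scalars and product $(p\cdot p')(z,z')=\sum_{z\le z''\le z'}p(z,z'')p'(z'',z')$. A weak rank function is $r_B\in I(B)$ with nonnegative integer values, positive for $z<z'$, additive along chains. $\mathcal{I}(B)=\{p:\deg p(z,z')\le r_B(z,z')\}$ with involution $p^{\mathrm{rev}}(z,z';t)=t^{r_B(z,z')}p(z,z';t^{ -1})$; $\mathcal{I}_{1/2}(B)=\{p\in\mathcal{I}(B):\deg p(z,z')<r_B(z,z')/2$ for $z<z'\}$; $U(B)=\{p:p(z,z)=1\}$. A $B$-kernel is $\kappa\in\mathcal{I}(B)\cap U(B)$ with $\kappa^{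 -1}=\kappa^{\mathrm{rev}}$; its right and left KLS functions are the unique $f_B,g_B\in\mathcal{I}_{1/2}(B)\cap U(B)$ with $f_B^{\mathrm{rev}}=\kappa\cdot f_B$, $g_B^{\mathrm{rev}}=g_B\cdot\kappa$. For $p\in\mathcal{I}(B)$, $\Delta p$ is defined by $(\Delta p)(z,z)=0$ and, for $z<z'$ with $p(z,z')=\sum_ia_it^i$, $(\Delta p)(z,z')=a_0+\sum_{i=1}^{\lfloor(r_B(z,z')-1)/2\rfloor}(a_i-a_{i-1})t^i$. A poset is lower Eulerian if it has a unique minimal element, a rank function $\rho_B$ ($\rho_B(z')=\rho_B(z)+1$ when $z'$ covers $z$), and $\sum_{z\le z''\le z'}(-1)^{\rho_B(z'')}=0$ for $z<z'$; $\rho_B(z,z')=\rho_B(z')-\rho_B(z)$. For lower Eulerian $B$, $\widehat p(z,z')=(-1)^{\rho_B(z,z')}p(z,z')$; $p$ is rank alternating if $p^{\mathrm{rev}}=\widehat p$, multiplicative if $p(z,z')=p(z,z'')p(z'',z')$ for $z\le z''\le z'$; such elements of $\mathcal{I}(B)\cap U(B)$ are $B$-kernels. Setting: $X,Y$ lower Eulerian; $\sigma:X\to Y$ a strong formal subdivision: order-preserving; $\rho_X(x)\le\rho_Y(\sigma(x))$; surjective, and for $x\in X,y\in Y$ with $\sigma(x)\le y$ there is $x'\ge x$ with $\rho_X(x')=\rho_Y(y)$, $\sigma(x')=y$; and $\sum_{x\le x'\in X,\sigma(x')=y}(-1)^{\rho_Y(y)-\rho_X(x')}=1$ for all such $x,y$.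 $\Gamma$ is the poset on $X\sqcup Y$ with the orders of $X,Y$ and $x\le y$ ($x\in X,y\in Y$) iff $\sigma(x)\le y$; it is lower Eulerian with rank function $\rho_X$ on $X$ and $\rho_Y+1$ on $Y$. $f_\Gamma,g_\Gamma$ are the KLS functions of $\kappa_\Gamma$, $f_X$ is the restriction of $f_\Gamma$ to intervals in $X$. For $p\in\mathcal{I}(\Gamma)$, $p|_X,p|_{X/Y},p|_{(X/Y)^\circ}$ agree with $p$ on intervals $[z,z']$ with $z,z'\in X$; $z\in X,z'\in Y$; $z\in X, z'=\sigma(z)$ respectively, and are $0$ elsewhere. $h_\sigma,\ell_\sigma\in\mathcal{I}(\Gamma)$: $(t-1)\cdot h_\sigma=g_\Gamma\cdot\kappa_\Gamma|_{(X/Y)^\circ}$ (right side divisible by $t-1$), $\ell_\sigma=h_\sigma\cdot g_\Gamma^{ -1}$. Note $\Delta\widehat{\ell_\sigma}(x',y)=(-1)^{\rho_\Gamma(x',y)}\Delta\ell_\sigma(x',y)$. -}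

module Defs where

open import Level using (0ℓ)
open import Data.Bool using (Bool; true; false; if_then_else_; _∧_)
open import Data.Nat as ℕ using (ℕ; zero; suc; _∸_; _≤ᵇ_)
open import Data.Nat.DivMod using (_/_)
open import Data.Integer as ℤ using (ℤ; 0ℤ; 1ℤ; -1ℤ)
open import Data.Fin as Fin using (Fin; _↑ˡ_; _↑ʳ_; splitAt)
open import Data.Sum using (_⊎_; inj₁; inj₂)
open import Data.Product using (Σ; _×_; _,_; ∃; ∃-syntax)
open import Data.Empty using (⊥)
open import Relation.Nullary using (¬_; Dec; yes; no; does)
open import Relation.Binary using (Rel; Decidable; IsPartialOrder)
open import Relation.Binary.PropositionalEquality using (_≡_; _≢_)

-- Formal power series / polynomials over ℤ, as coefficient sequences.
-- Polynomiality (a degree bound) is imposed separately where needed.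

Series : Set
Series = ℕ → ℤ

_≈ₛ_ : Series → Series → Set
p ≈ₛ q = ∀ i → p i ≡ q i

zeroS : Series
zeroS _ = 0ℤ

oneS : Series
oneS zero    = 1ℤ
oneS (suc _) = 0ℤ

tMinus1 : Series
tMinus1 zero          = -1ℤ
tMinus1 (suc zero)    = 1ℤ
tMinus1 (suc (suc _)) = 0ℤ

_⊕_ : Series → Series → Series
(p ⊕ q) i = p i ℤ.+ q i

negS : Series → Series
negS p i = ℤ.- (p i)

scaleS : ℤ → Series → Series
scaleS c p i = c ℤ.* p i

sumUpTo : ℕ → (ℕ → ℤ) → ℤ
sumUpTo zero    f = f 0
sumUpTo (suc k) f = sumUpTo k f ℤ.+ f (suc k)

_⊛_ : Series → Series → Series
(p ⊛ q) k = sumUpTo k (λ i → p i ℤ.* q (k ∸ i))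

sumFin : (n : ℕ) → (Fin n → ℤ) → ℤ
sumFin zero    f = 0ℤ
sumFin (suc n) f = f Fin.zero ℤ.+ sumFin n (λ i → f (Fin.suc i))

sumFinS : (n : ℕ) → (Fin n → Series) → Series
sumFinS n F k = sumFin n (λ w → F w k)

sgn : ℕ → ℤ
sgn n = -1ℤ ℤ.^ n

-- Finite sets Fin n equipped with a decidable relation (the order).
-- Order axioms are imposed as hypotheses where the paper assumes them.

record FinOrd : Set₁ where
  field
    size : ℕ
    _≤_  : Rel (Fin size) 0ℓ
    _≤?_ : Decidable _≤_

module _ (B : FinOrd) where
  open FinOrd B

  Elt : Set
  Elt = Fin size

  _<_ : Elt → Elt → Set
  z < z' = (z ≤ z') × (z ≢ z')

  Covers : Elt → Elt → Set
  Covers z z' = (z < z') × (∀ w → z < w → ¬ (w < z'))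

  Minimal : Elt → Set
  Minimal m = ∀ z → z ≤ m → z ≡ m

  inInt : Elt → Elt → Elt → Bool
  inInt z w z' = does (z ≤? w) ∧ does (w ≤? z')

  -- Elements of the incidence algebra I(B): only the values on
  -- intervals z ≤ z' are relevant.
  Inc : Set
  Inc = Elt → Elt → Series

  EqI : Inc → Inc → Set
  EqI p q = ∀ z z' → z ≤ z' → p z z' ≈ₛ q z z'

  mul : Inc → Inc → Inc
  mul p q z z' = sumFinS size (λ w → if inInt z w z' then p z w ⊛ q w z' else zeroS)

  oneI : Inc
  oneI z z' with z Fin.≟ z'
  ... | yes _ = oneS
  ... | no  _ = zeroS

  negI : Inc → Inc
  negI p z z' = negS (p z z')

  IsWeakRank : (Elt → Elt → ℕ) → Set
  IsWeakRank r =
    (∀ z z' → z < z' → 0 ℕ.< r z z') ×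
    (∀ z z'' z' → z ≤ z'' → z'' ≤ z' → r z z' ≡ r z z'' ℕ.+ r z'' z')

  module _ (r : Elt → Elt → ℕ) where

    InCalI : Inc → Set
    InCalI p = ∀ z z' → z ≤ z' → ∀ i → r z z' ℕ.< i → p z z' i ≡ 0ℤ

    InCalIhalf : Inc → Set
    InCalIhalf p = InCalI p ×
      (∀ z z' → z < z' → ∀ i → r z z' ℕ.≤ 2 ℕ.* i → p z z' i ≡ 0ℤ)

    InU : Inc → Set
    InU p = ∀ z → p z z ≈ₛ oneS

    -- p^rev(z,z';t) = t^{r(z,z')} p(z,z';t⁻¹)
    rev : Inc → Inc
    rev p z z' i = if i ≤ᵇ r z z' then p z z' (r z z' ∸ i) else 0ℤ

    IsRightKLS : Inc → Inc → Set
    IsRightKLS κ f = InCalIhalf f × InU f × EqI (rev f) (mul κ f)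

    IsLeftKLS : Inc → Inc → Set
    IsLeftKLS κ g = InCalIhalf g × InU g × EqI (rev g) (mul g κ)

    Δ : Inc → Inc
    Δ p z z' with z Fin.≟ z'
    ... | yes _ = zeroS
    ... | no  _ = ΔS
      where
        ΔS : Series
        ΔS zero = p z z' 0
        ΔS (suc i) = if suc i ≤ᵇ ((r z z' ∸ 1) / 2)
                     then p z z' (suc i) ℤ.- p z z' i else 0ℤ

  module _ (ρ : Elt → ℕ) where

    hat : Inc → Inc
    hat p z z' = scaleS (sgn (ρ z' ∸ ρ z)) (p z z')

    IsLowerEulerian : Set
    IsLowerEulerian =
      IsPartialOrder _≡_ _≤_ ×
      (Σ Elt λ m → Minimal m × (∀ m' → Minimal m' → m' ≡ m) × ρ m ≡ 0) ×
      (∀ z z' → Covers z z' → ρ z' ≡ suc (ρ z)) ×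
      (∀ z z' → z < z' →
         sumFin size (λ w → if inInt z w z' then sgn (ρ w) else 0ℤ) ≡ 0ℤ)

  Multiplicative : Inc → Set
  Multiplicative p = ∀ z z'' z' → z ≤ z'' → z'' ≤ z' →
    p z z' ≈ₛ (p z z'' ⊛ p z'' z')

  RankAlternating : (Elt → Elt → ℕ) → (Elt → ℕ) → Inc → Set
  RankAlternating r ρ p = EqI (rev r p) (hat ρ p)

module _ (X Y : FinOrd) where
  private
    module X = FinOrd X
    module Y = FinOrd Y

  IsStrongFormalSubdivision :
    (ρX : Fin X.size → ℕ) (ρY : Fin Y.size → ℕ) (σ : Fin X.size → Fin Y.size) → Set
  IsStrongFormalSubdivision ρX ρY σ =
    (∀ x x' → x X.≤ x' → σ x Y.≤ σ x') ×
    (∀ x → ρX x ℕ.≤ ρY (σ x)) ×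
    (∀ y → ∃[ x ] σ x ≡ y) ×
    (∀ x y → σ x Y.≤ y → ∃[ x' ] (x X.≤ x' × ρX x' ≡ ρY y × σ x' ≡ y)) ×
    (∀ x y → σ x Y.≤ y →
       sumFin X.size (λ x' → if does (x X.≤? x') ∧ does (σ x' Fin.≟ y)
                              then sgn (ρY y ∸ ρX x') else 0ℤ) ≡ 1ℤ)

  module _ (σ : Fin X.size → Fin Y.size) where

    GLe : Fin X.size ⊎ Fin Y.size → Fin X.size ⊎ Fin Y.size → Set
    GLe (inj₁ x) (inj₁ x') = x X.≤ x'
    GLe (inj₁ x) (inj₂ y)  = σ x Y.≤ y
    GLe (inj₂ y) (inj₁ x)  = ⊥
    GLe (inj₂ y) (inj₂ y') = y Y.≤ y'

    GLe? : (a b : Fin X.size ⊎ Fin Y.size) → Dec (GLe a b)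
    GLe? (inj₁ x) (inj₁ x') = x X.≤? x'
    GLe? (inj₁ x) (inj₂ y)  = σ x Y.≤? y
    GLe? (inj₂ y) (inj₁ x)  = no (λ ())
    GLe? (inj₂ y) (inj₂ y') = y Y.≤? y'

    -- Γ, with carrier Fin (|X| + |Y|): the first |X| elements are X,
    -- the remaining |Y| elements are Y.
    Gam : FinOrd
    Gam = record
      { size = X.size ℕ.+ Y.size
      ; _≤_  = λ a b → GLe (splitAt X.size a) (splitAt X.size b)
      ; _≤?_ = λ a b → GLe? (splitAt X.size a) (splitAt X.size b)
      }

    inX : Fin X.size → Fin (X.size ℕ.+ Y.size)
    inX x = x ↑ˡ Y.size

    inY : Fin Y.size → Fin (X.size ℕ.+ Y.size)
    inY y = X.size ↑ʳ y

    ρGam : (Fin X.size → ℕ) → (Fin Y.size → ℕ) → Fin (X.size ℕ.+ Y.size) → ℕ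
    ρGam ρX ρY a with splitAt X.size a
    ... | inj₁ x = ρX x
    ... | inj₂ y = suc (ρY y)

    resX : Inc Gam → Inc Gam
    resX p a b with splitAt X.size a | splitAt X.size b
    ... | inj₁ _ | inj₁ _ = p a b
    ... | _      | _      = zeroS

    resXY : Inc Gam → Inc Gam
    resXY p a b with splitAt X.size a | splitAt X.size b
    ... | inj₁ _ | inj₂ _ = p a b
    ... | _      | _      = zeroS

    resXYo : Inc Gam → Inc Gam
    resXYo p a b with splitAt X.size a | splitAt X.size b
    ... | inj₁ x | inj₂ y = if does (σ x Fin.≟ y) then p a b else zeroS
    ... | _      | _      = zeroS

-- Since κ is multiplicative and Γ is Eulerian, κ̂ · κ = 1; together with the
-- defining equations of the KLS functions this makes ĝ · f palindromic, hence
-- ĝ · f = 1 and g⁻¹ = f̂. Thus (t - 1) ℓ = g · κ° · f̂ =: M, where κ° = κ|(X/Y)°,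
-- and the identities κ · κ̂° = -κ|X/Y and κ|X/Y · κ̂ = κ° show that M is
-- antipalindromic. Then D = Δ ℓ̂ is the lower half of Q = -M̂ = (1 - t) ℓ̂, so
-- rev D = D - Q, and G = f + f · D satisfies rev G = κ · G - κ|X/Y · f. By
-- induction on the rank of an interval [x, y] from X to Y, G(x, y) is palindromic
-- of degree below half the rank, so G(x, y) = 0, which is f|X/Y = -f · D. Since D
-- vanishes on intervals starting in Y, only x′ ∈ X contribute, and there
-- D(x′, y) = -(-1)^{ρY(y) - ρX(x′)} Δℓ(x′, y).

module Submission where

open import Defs
open import Level using (0ℓ)
open import Data.Nat as ℕ using (ℕ; zero; suc; _∸_; _≤ᵇ_; z≤n; s≤s; _⊔_)
import Data.Nat.Properties as ℕ
open import Data.Nat.DivMod using (_/_; m/n*n≤m; m*n/n≡m; /-monoˡ-≤)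
import Data.Nat.Tactic.RingSolver as ℕ-Solver
open import Data.Integer as ℤ using (ℤ; 0ℤ; 1ℤ; -1ℤ; _+_; _*_; -_; _-_)
import Data.Integer.Properties as ℤ
open import Data.Integer.Tactic.RingSolver using (solve-∀)
open import Data.Fin as Fin using (Fin; _↑ˡ_; _↑ʳ_; splitAt; join)
import Data.Fin.Properties as Fin
open import Data.Bool using (Bool; true; false; if_then_else_; T; _∧_)
open import Data.Unit using (tt)
open import Data.Product using (Σ; _×_; _,_; proj₁; proj₂)
open import Data.Sum using (inj₁; inj₂)
open import Data.Empty using (⊥-elim)
open import Function using (_∘_)
open import Relation.Nullary using (¬_; Dec; yes; no; does)
open import Relation.Nullary.Decidable using (dec-true; dec-false; _×-dec_; ¬?)
open import Relation.Binary using (Setoid; IsPartialOrder; tri<; tri≈; tri>)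
open import Relation.Binary.PropositionalEquality
import Relation.Binary.Reasoning.Setoid as SetoidReasoning
open import Algebra.Bundles using (AbelianGroup)
import Algebra.Properties.Group as GroupProperties

if-≤ᵇ-true : ∀ {m n} {A : Set} {x y : A} → m ℕ.≤ n → (if m ≤ᵇ n then x else y) ≡ x
if-≤ᵇ-true {m} {n} m≤n with m ≤ᵇ n | ℕ.≤⇒≤ᵇ m≤n
... | true | _ = refl

if-≤ᵇ-false : ∀ {m n} {A : Set} {x y : A} → ¬ m ℕ.≤ n → (if m ≤ᵇ n then x else y) ≡ y
if-≤ᵇ-false {m} {n} m≰n with m ≤ᵇ n in eq
... | true  = ⊥-elim (m≰n (ℕ.≤ᵇ⇒≤ m n (subst T (sym eq) tt)))
... | false = refl

≡true⇔⇒≡ : ∀ {b c : Bool} → (b ≡ true → c ≡ true) → (c ≡ true → b ≡ true) → b ≡ c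
≡true⇔⇒≡ {true}  {true}  _ _ = refl
≡true⇔⇒≡ {true}  {false} b⇒c _ = sym (b⇒c refl)
≡true⇔⇒≡ {false} {true}  _ c⇒b = c⇒b refl
≡true⇔⇒≡ {false} {false} _ _ = refl

∧≡true⁻ : ∀ {b c : Bool} → b ∧ c ≡ true → b ≡ true × c ≡ true
∧≡true⁻ {true} {true} _ = refl , refl

∧≡true⁺ : ∀ {b c : Bool} → b ≡ true → c ≡ true → b ∧ c ≡ true
∧≡true⁺ refl refl = refl

-- Finite sums and power series

+-interchange : ∀ a b c d → (a + b) + (c + d) ≡ (a + c) + (b + d)
+-interchange = solve-∀

sumUpTo-cong : ∀ k {f g : ℕ → ℤ} → (∀ i → i ℕ.≤ k → f i ≡ g i) → sumUpTo k f ≡ sumUpTo k g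
sumUpTo-cong zero    f≗g = f≗g 0 z≤n
sumUpTo-cong (suc k) f≗g =
  cong₂ _+_ (sumUpTo-cong k (λ i i≤k → f≗g i (ℕ.m≤n⇒m≤1+n i≤k))) (f≗g (suc k) ℕ.≤-refl)

sumUpTo-+ : ∀ k (f g : ℕ → ℤ) → sumUpTo k (λ i → f i + g i) ≡ sumUpTo k f + sumUpTo k g
sumUpTo-+ zero    f g = refl
sumUpTo-+ (suc k) f g = trans (cong (_+ (f (suc k) + g (suc k))) (sumUpTo-+ k f g))
  (+-interchange (sumUpTo k f) (sumUpTo k g) (f (suc k)) (g (suc k)))

sumUpTo-*ˡ : ∀ k c (f : ℕ → ℤ) → sumUpTo k (λ i → c * f i) ≡ c * sumUpTo k f
sumUpTo-*ˡ zero    c f = refl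
sumUpTo-*ˡ (suc k) c f = trans (cong (_+ c * f (suc k)) (sumUpTo-*ˡ k c f))
  (sym (ℤ.*-distribˡ-+ c (sumUpTo k f) (f (suc k))))

sumUpTo-zero : ∀ k {f : ℕ → ℤ} → (∀ i → i ℕ.≤ k → f i ≡ 0ℤ) → sumUpTo k f ≡ 0ℤ
sumUpTo-zero k f≗0 = trans (sumUpTo-cong k f≗0) (sumUpTo-*ˡ k 0ℤ (λ _ → 0ℤ))

sumUpTo-suc : ∀ k (f : ℕ → ℤ) → sumUpTo (suc k) f ≡ f 0 + sumUpTo k (λ i → f (suc i))
sumUpTo-suc zero    f = refl
sumUpTo-suc (suc k) f = trans (cong (_+ f (suc (suc k))) (sumUpTo-suc k f))
  (ℤ.+-assoc (f 0) (sumUpTo k (λ i → f (suc i))) (f (suc (suc k))))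

sumUpTo-reverse : ∀ k (f : ℕ → ℤ) → sumUpTo k f ≡ sumUpTo k (λ i → f (k ∸ i))
sumUpTo-reverse zero    f = refl
sumUpTo-reverse (suc k) f = begin
  sumUpTo k f + f (suc k)                        ≡⟨ cong (_+ f (suc k)) (sumUpTo-reverse k f) ⟩
  sumUpTo k (λ i → f (k ∸ i)) + f (suc k)        ≡⟨ ℤ.+-comm _ (f (suc k)) ⟩
  f (suc k) + sumUpTo k (λ i → f (k ∸ i))        ≡⟨ sumUpTo-suc k (λ i → f (suc k ∸ i)) ⟨
  sumUpTo (suc k) (λ i → f (suc k ∸ i))          ∎
  where open ≡-Reasoning

sumUpTo-extend : ∀ {k m} (f : ℕ → ℤ) → k ℕ.≤ m → (∀ i → k ℕ.< i → f i ≡ 0ℤ) →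
                 sumUpTo m f ≡ sumUpTo k f
sumUpTo-extend f k≤m f≗0 = go f (ℕ.≤⇒≤′ k≤m) f≗0
  where
  go : ∀ {k m} (f : ℕ → ℤ) → k ℕ.≤′ m → (∀ i → k ℕ.< i → f i ≡ 0ℤ) → sumUpTo m f ≡ sumUpTo k f
  go f ℕ.≤′-refl         f≗0 = refl
  go f (ℕ.≤′-step {m} p) f≗0 =
    trans (cong₂ _+_ (go f p f≗0) (f≗0 (suc m) (s≤s (ℕ.≤′⇒≤ p)))) (ℤ.+-identityʳ _)

sumFin-cong : ∀ n {f g : Fin n → ℤ} → (∀ w → f w ≡ g w) → sumFin n f ≡ sumFin n g
sumFin-cong zero    f≗g = refl
sumFin-cong (suc n) f≗g = cong₂ _+_ (f≗g Fin.zero) (sumFin-cong n (λ w → f≗g (Fin.suc w)))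

sumFin-+ : ∀ n (f g : Fin n → ℤ) → sumFin n (λ w → f w + g w) ≡ sumFin n f + sumFin n g
sumFin-+ zero    f g = refl
sumFin-+ (suc n) f g = trans (cong (f Fin.zero + g Fin.zero +_) (sumFin-+ n _ _))
  (+-interchange (f Fin.zero) (g Fin.zero) _ _)

sumFin-*ˡ : ∀ n c (f : Fin n → ℤ) → sumFin n (λ w → c * f w) ≡ c * sumFin n f
sumFin-*ˡ zero    c f = sym (ℤ.*-zeroʳ c)
sumFin-*ˡ (suc n) c f = trans (cong (c * f Fin.zero +_) (sumFin-*ˡ n c _)) (sym (ℤ.*-distribˡ-+ c _ _))

sumFin-zero : ∀ n {f : Fin n → ℤ} → (∀ w → f w ≡ 0ℤ) → sumFin n f ≡ 0ℤ
sumFin-zero zero    f≗0 = refl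
sumFin-zero (suc n) f≗0 = cong₂ _+_ (f≗0 Fin.zero) (sumFin-zero n (λ w → f≗0 (Fin.suc w)))

sumFin-neg : ∀ n (f : Fin n → ℤ) → sumFin n (λ w → - f w) ≡ - sumFin n f
sumFin-neg n f = begin
  sumFin n (λ w → - f w)      ≡⟨ sumFin-cong n (λ w → sym (ℤ.-1*i≡-i (f w))) ⟩
  sumFin n (λ w → -1ℤ * f w)  ≡⟨ sumFin-*ˡ n -1ℤ f ⟩
  -1ℤ * sumFin n f            ≡⟨ ℤ.-1*i≡-i _ ⟩
  - sumFin n f                ∎
  where open ≡-Reasoning

sumFin-comm : ∀ n m (F : Fin n → Fin m → ℤ) →
              sumFin n (λ a → sumFin m (F a)) ≡ sumFin m (λ b → sumFin n (λ a → F a b))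
sumFin-comm zero    m F = sym (sumFin-zero m (λ _ → refl))
sumFin-comm (suc n) m F = trans (cong (sumFin m (F Fin.zero) +_) (sumFin-comm n m (λ a → F (Fin.suc a))))
  (sym (sumFin-+ m (F Fin.zero) (λ b → sumFin n (λ a → F (Fin.suc a) b))))

sumFin-sumUpTo-comm : ∀ n k (F : Fin n → ℕ → ℤ) →
                      sumFin n (λ w → sumUpTo k (F w)) ≡ sumUpTo k (λ i → sumFin n (λ w → F w i))
sumFin-sumUpTo-comm n zero    F = refl
sumFin-sumUpTo-comm n (suc k) F = trans (sumFin-+ n (λ w → sumUpTo k (F w)) (λ w → F w (suc k)))
  (cong (_+ sumFin n (λ w → F w (suc k))) (sumFin-sumUpTo-comm n k F))

sumFin-select : ∀ n (f : Fin n → ℤ) (a : Fin n) → (∀ w → w ≢ a → f w ≡ 0ℤ) → sumFin n f ≡ f a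
sumFin-select (suc n) f Fin.zero f≗0 =
  trans (cong (f Fin.zero +_) (sumFin-zero n (λ w → f≗0 (Fin.suc w) (λ ())))) (ℤ.+-identityʳ _)
sumFin-select (suc n) f (Fin.suc a) f≗0 =
  trans (cong₂ _+_ (f≗0 Fin.zero (λ ()))
                   (sumFin-select n (λ w → f (Fin.suc w)) a
                      (λ w w≢a → f≗0 (Fin.suc w) (λ e → w≢a (Fin.suc-injective e)))))
        (ℤ.+-identityˡ _)

sumFin-↑ : ∀ m n (f : Fin (m ℕ.+ n) → ℤ) →
           sumFin (m ℕ.+ n) f ≡ sumFin m (λ i → f (i ↑ˡ n)) + sumFin n (λ j → f (m ↑ʳ j))
sumFin-↑ zero    n f = sym (ℤ.+-identityˡ _)
sumFin-↑ (suc m) n f = trans (cong (f Fin.zero +_) (sumFin-↑ m n (λ w → f (Fin.suc w))))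
  (sym (ℤ.+-assoc (f Fin.zero) _ _))

≈ₛ-refl : ∀ {p} → p ≈ₛ p
≈ₛ-refl i = refl

≈ₛ-sym : ∀ {p q} → p ≈ₛ q → q ≈ₛ p
≈ₛ-sym p≈q i = sym (p≈q i)

≈ₛ-trans : ∀ {p q s} → p ≈ₛ q → q ≈ₛ s → p ≈ₛ s
≈ₛ-trans p≈q q≈s i = trans (p≈q i) (q≈s i)

≈ₛ-setoid : Setoid 0ℓ 0ℓ
≈ₛ-setoid = record
  { Carrier = Series ; _≈_ = _≈ₛ_
  ; isEquivalence = record { refl = ≈ₛ-refl ; sym = ≈ₛ-sym ; trans = ≈ₛ-trans } }

module ≈ₛ-Reasoning = SetoidReasoning ≈ₛ-setoid

⊕-cong : ∀ {s s′ t t′} → s ≈ₛ s′ → t ≈ₛ t′ → (s ⊕ t) ≈ₛ (s′ ⊕ t′)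
⊕-cong s≈s′ t≈t′ i = cong₂ _+_ (s≈s′ i) (t≈t′ i)

negS-cong : ∀ {s t} → s ≈ₛ t → negS s ≈ₛ negS t
negS-cong s≈t i = cong -_ (s≈t i)

scaleS-cong : ∀ c {s t} → s ≈ₛ t → scaleS c s ≈ₛ scaleS c t
scaleS-cong c s≈t i = cong (c *_) (s≈t i)

scaleS-scaleS : ∀ c d s → scaleS c (scaleS d s) ≈ₛ scaleS (c * d) s
scaleS-scaleS c d s i = sym (ℤ.*-assoc c d (s i))

scaleS-zero : ∀ c → scaleS c zeroS ≈ₛ zeroS
scaleS-zero c i = ℤ.*-zeroʳ c

negS-involutive : ∀ s → negS (negS s) ≈ₛ s
negS-involutive s i = ℤ.neg-involutive (s i)

⊛-cong : ∀ {p p′ q q′} → p ≈ₛ p′ → q ≈ₛ q′ → (p ⊛ q) ≈ₛ (p′ ⊛ q′)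
⊛-cong p≈p′ q≈q′ k = sumUpTo-cong k (λ i _ → cong₂ _*_ (p≈p′ i) (q≈q′ (k ∸ i)))

⊛-congˡ : ∀ p {q q′} → q ≈ₛ q′ → (p ⊛ q) ≈ₛ (p ⊛ q′)
⊛-congˡ p = ⊛-cong {p} ≈ₛ-refl

⊛-congʳ : ∀ {p p′} q → p ≈ₛ p′ → (p ⊛ q) ≈ₛ (p′ ⊛ q)
⊛-congʳ q p≈p′ = ⊛-cong p≈p′ (≈ₛ-refl {q})

shift : Series → Series
shift p i = p (suc i)

⊛-suc : ∀ p q k → (p ⊛ q) (suc k) ≡ p 0 * q (suc k) + (shift p ⊛ q) k
⊛-suc p q k = sumUpTo-suc k (λ i → p i * q (suc k ∸ i))

⊛-distribʳ-⊕ : ∀ p q s → ((p ⊕ q) ⊛ s) ≈ₛ ((p ⊛ s) ⊕ (q ⊛ s))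
⊛-distribʳ-⊕ p q s k =
  trans (sumUpTo-cong k (λ i _ → ℤ.*-distribʳ-+ (s (k ∸ i)) (p i) (q i))) (sumUpTo-+ k _ _)

⊛-distribˡ-⊕ : ∀ p q s → (p ⊛ (q ⊕ s)) ≈ₛ ((p ⊛ q) ⊕ (p ⊛ s))
⊛-distribˡ-⊕ p q s k =
  trans (sumUpTo-cong k (λ i _ → ℤ.*-distribˡ-+ (p i) (q (k ∸ i)) (s (k ∸ i)))) (sumUpTo-+ k _ _)

⊛-scaleSˡ : ∀ c p q → (scaleS c p ⊛ q) ≈ₛ scaleS c (p ⊛ q)
⊛-scaleSˡ c p q k = trans (sumUpTo-cong k (λ i _ → ℤ.*-assoc c (p i) (q (k ∸ i)))) (sumUpTo-*ˡ k c _)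

⊛-scaleSʳ : ∀ c p q → (p ⊛ scaleS c q) ≈ₛ scaleS c (p ⊛ q)
⊛-scaleSʳ c p q k =
  trans (sumUpTo-cong k (λ i _ → *-left-comm (p i) c (q (k ∸ i)))) (sumUpTo-*ˡ k c _)
  where
  *-left-comm : ∀ a c b → a * (c * b) ≡ c * (a * b)
  *-left-comm = solve-∀

⊛-zeroˡ : ∀ q → (zeroS ⊛ q) ≈ₛ zeroS
⊛-zeroˡ q k = sumUpTo-zero k (λ i _ → ℤ.*-zeroˡ (q (k ∸ i)))

⊛-zeroʳ : ∀ p → (p ⊛ zeroS) ≈ₛ zeroS
⊛-zeroʳ p k = sumUpTo-zero k (λ i _ → ℤ.*-zeroʳ (p i))

⊛-vanishesˡ : ∀ {s} t → s ≈ₛ zeroS → (s ⊛ t) ≈ₛ zeroS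
⊛-vanishesˡ t s≈0 = ≈ₛ-trans (⊛-congʳ t s≈0) (⊛-zeroˡ t)

⊛-vanishesʳ : ∀ s {t} → t ≈ₛ zeroS → (s ⊛ t) ≈ₛ zeroS
⊛-vanishesʳ s t≈0 = ≈ₛ-trans (⊛-congˡ s t≈0) (⊛-zeroʳ s)

⊛-identityˡ : ∀ q → (oneS ⊛ q) ≈ₛ q
⊛-identityˡ q zero    = ℤ.*-identityˡ (q 0)
⊛-identityˡ q (suc k) = trans (⊛-suc oneS q k)
  (trans (cong₂ _+_ (ℤ.*-identityˡ (q (suc k))) (⊛-zeroˡ q k)) (ℤ.+-identityʳ _))

⊛-identityʳ : ∀ p → (p ⊛ oneS) ≈ₛ p
⊛-identityʳ p zero    = ℤ.*-identityʳ (p 0)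
⊛-identityʳ p (suc k) =
  trans (cong₂ _+_ (sumUpTo-zero k below-k) (trans (cong (λ j → p (suc k) * oneS j) (ℕ.n∸n≡0 k))
                                                   (ℤ.*-identityʳ (p (suc k)))))
        (ℤ.+-identityˡ _)
  where
  below-k : ∀ i → i ℕ.≤ k → p i * oneS (suc k ∸ i) ≡ 0ℤ
  below-k i i≤k rewrite ℕ.+-∸-assoc 1 i≤k = ℤ.*-zeroʳ (p i)

⊛-assoc : ∀ p q s → ((p ⊛ q) ⊛ s) ≈ₛ (p ⊛ (q ⊛ s))
⊛-assoc p q s zero    = ℤ.*-assoc (p 0) (q 0) (s 0)
⊛-assoc p q s (suc k) = begin
  ((p ⊛ q) ⊛ s) (suc k)
    ≡⟨ ⊛-suc (p ⊛ q) s k ⟩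
  (p 0 * q 0) * s (suc k) + (shift (p ⊛ q) ⊛ s) k
    ≡⟨ cong (p 0 * q 0 * s (suc k) +_) (⊛-congʳ s shift-⊛ k) ⟩
  (p 0 * q 0) * s (suc k) + ((scaleS (p 0) (shift q) ⊕ (shift p ⊛ q)) ⊛ s) k
    ≡⟨ cong (p 0 * q 0 * s (suc k) +_) (⊛-distribʳ-⊕ (scaleS (p 0) (shift q)) (shift p ⊛ q) s k) ⟩
  (p 0 * q 0) * s (suc k) + ((scaleS (p 0) (shift q) ⊛ s) k + ((shift p ⊛ q) ⊛ s) k)
    ≡⟨ cong₂ (λ u v → p 0 * q 0 * s (suc k) + (u + v)) (⊛-scaleSˡ (p 0) (shift q) s k) (⊛-assoc (shift p) q s k) ⟩
  (p 0 * q 0) * s (suc k) + (p 0 * (shift q ⊛ s) k + (shift p ⊛ (q ⊛ s)) k)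
    ≡⟨ regroup (p 0) (q 0) (s (suc k)) ((shift q ⊛ s) k) ((shift p ⊛ (q ⊛ s)) k) ⟩
  p 0 * (q 0 * s (suc k) + (shift q ⊛ s) k) + (shift p ⊛ (q ⊛ s)) k
    ≡⟨ cong (λ u → p 0 * u + (shift p ⊛ (q ⊛ s)) k) (⊛-suc q s k) ⟨
  p 0 * (q ⊛ s) (suc k) + (shift p ⊛ (q ⊛ s)) k
    ≡⟨ ⊛-suc p (q ⊛ s) k ⟨
  (p ⊛ (q ⊛ s)) (suc k) ∎
  where
  open ≡-Reasoning
  shift-⊛ : shift (p ⊛ q) ≈ₛ (scaleS (p 0) (shift q) ⊕ (shift p ⊛ q))
  shift-⊛ = ⊛-suc p q
  regroup : ∀ a b c d e → (a * b) * c + (a * d + e) ≡ a * (b * c + d) + e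
  regroup = solve-∀

negS-⊛ : ∀ s t → (negS s ⊛ t) ≈ₛ negS (s ⊛ t)
negS-⊛ s t = ≈ₛ-trans (⊛-congʳ t (λ k → sym (ℤ.-1*i≡-i (s k))))
  (≈ₛ-trans (⊛-scaleSˡ -1ℤ s t) (λ k → ℤ.-1*i≡-i ((s ⊛ t) k)))

⊛-negS : ∀ s t → (s ⊛ negS t) ≈ₛ negS (s ⊛ t)
⊛-negS s t = ≈ₛ-trans (⊛-congˡ s (λ k → sym (ℤ.-1*i≡-i (t k))))
  (≈ₛ-trans (⊛-scaleSʳ -1ℤ s t) (λ k → ℤ.-1*i≡-i ((s ⊛ t) k)))

tMinus1-⊛-zero : ∀ p → (tMinus1 ⊛ p) 0 ≡ - p 0
tMinus1-⊛-zero p = ℤ.-1*i≡-i (p 0)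

tMinus1-⊛-suc : ∀ p k → (tMinus1 ⊛ p) (suc k) ≡ p k - p (suc k)
tMinus1-⊛-suc p k = begin
  (tMinus1 ⊛ p) (suc k)              ≡⟨ ⊛-suc tMinus1 p k ⟩
  -1ℤ * p (suc k) + (shift tMinus1 ⊛ p) k
    ≡⟨ cong₂ _+_ (ℤ.-1*i≡-i (p (suc k))) (⊛-congʳ p shift-tMinus1 k) ⟩
  - p (suc k) + (oneS ⊛ p) k          ≡⟨ cong (- p (suc k) +_) (⊛-identityˡ p k) ⟩
  - p (suc k) + p k                   ≡⟨ ℤ.+-comm (- p (suc k)) (p k) ⟩
  p k - p (suc k)                     ∎
  where
  open ≡-Reasoning
  shift-tMinus1 : shift tMinus1 ≈ₛ oneS
  shift-tMinus1 zero    = refl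
  shift-tMinus1 (suc i) = refl

-- Degree bounds and reversal

Deg≤ : ℕ → Series → Set
Deg≤ n p = ∀ i → n ℕ.< i → p i ≡ 0ℤ

Deg<½ : ℕ → Series → Set
Deg<½ n p = ∀ i → n ℕ.≤ 2 ℕ.* i → p i ≡ 0ℤ

revS : ℕ → Series → Series
revS n p i = if i ≤ᵇ n then p (n ∸ i) else 0ℤ

Deg≤-cong : ∀ {n s t} → s ≈ₛ t → Deg≤ n s → Deg≤ n t
Deg≤-cong s≈t s≤n i n<i = trans (sym (s≈t i)) (s≤n i n<i)

Deg<½-cong : ∀ {n s t} → s ≈ₛ t → Deg<½ n s → Deg<½ n t
Deg<½-cong s≈t s<n i n≤2i = trans (sym (s≈t i)) (s<n i n≤2i)

Deg<½-mono : ∀ {m n p} → m ℕ.≤ n → Deg<½ m p → Deg<½ n p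
Deg<½-mono m≤n p<m i n≤2i = p<m i (ℕ.≤-trans m≤n n≤2i)

Deg≤-scaleS : ∀ {n} c s → Deg≤ n s → Deg≤ n (scaleS c s)
Deg≤-scaleS c s s≤n i n<i = trans (cong (c *_) (s≤n i n<i)) (ℤ.*-zeroʳ c)

Deg<½-scaleS : ∀ {n} c s → Deg<½ n s → Deg<½ n (scaleS c s)
Deg<½-scaleS c s s<n i n≤2i = trans (cong (c *_) (s<n i n≤2i)) (ℤ.*-zeroʳ c)

Deg<½-⊕ : ∀ {n s t} → Deg<½ n s → Deg<½ n t → Deg<½ n (s ⊕ t)
Deg<½-⊕ s<n t<n i n≤2i = cong₂ _+_ (s<n i n≤2i) (t<n i n≤2i)

Deg<½-oneS : Deg<½ 1 oneS
Deg<½-oneS zero    ()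
Deg<½-oneS (suc i) _ = refl

Deg<½-zeroS : ∀ n → Deg<½ n zeroS
Deg<½-zeroS n i _ = refl

Deg≤-revS : ∀ n p → Deg≤ n (revS n p)
Deg≤-revS n p i n<i = if-≤ᵇ-false (ℕ.<⇒≱ n<i)

Deg≤-⊛ : ∀ a b {p q : Series} → Deg≤ a p → Deg≤ b q → Deg≤ (a ℕ.+ b) (p ⊛ q)
Deg≤-⊛ a b {p} {q} p≤a q≤b k a+b<k = sumUpTo-zero k term
  where
  term : ∀ i → i ℕ.≤ k → p i * q (k ∸ i) ≡ 0ℤ
  term i i≤k with i ℕ.≤? a
  ... | no  i≰a = trans (cong (_* q (k ∸ i)) (p≤a i (ℕ.≰⇒> i≰a))) (ℤ.*-zeroˡ (q (k ∸ i)))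
  ... | yes i≤a = trans (cong (p i *_) (q≤b (k ∸ i) b<k∸i)) (ℤ.*-zeroʳ (p i))
    where
    b<k∸i : b ℕ.< k ∸ i
    b<k∸i = ℕ.m+n≤o⇒m≤o∸n (suc b) (ℕ.≤-trans (s≤s (ℕ.+-monoʳ-≤ b i≤a))
              (subst (ℕ._≤ k) (cong suc (ℕ.+-comm a b)) a+b<k))

Deg<½-⊛ : ∀ a b {p q : Series} → Deg<½ a p → Deg<½ b q →
          ∀ k → a ℕ.+ b ℕ.≤ suc (2 ℕ.* k) → (p ⊛ q) k ≡ 0ℤ
Deg<½-⊛ a b {p} {q} p<a q<b k a+b≤1+2k = sumUpTo-zero k term
  where
  term : ∀ i → i ℕ.≤ k → p i * q (k ∸ i) ≡ 0ℤ
  term i i≤k with a ℕ.≤? 2 ℕ.* i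
  ... | yes a≤2i = trans (cong (_* q (k ∸ i)) (p<a i a≤2i)) (ℤ.*-zeroˡ (q (k ∸ i)))
  ... | no  a≰2i = trans (cong (p i *_) (q<b (k ∸ i) b≤2[k∸i])) (ℤ.*-zeroʳ (p i))
    where
    b+2i<1+2k : suc (b ℕ.+ 2 ℕ.* i) ℕ.≤ suc (2 ℕ.* k)
    b+2i<1+2k = ℕ.≤-trans (subst (ℕ._≤ b ℕ.+ a) (ℕ.+-suc b (2 ℕ.* i)) (ℕ.+-monoʳ-≤ b (ℕ.≰⇒> a≰2i)))
                  (subst (ℕ._≤ suc (2 ℕ.* k)) (ℕ.+-comm a b) a+b≤1+2k)
    b≤2[k∸i] : b ℕ.≤ 2 ℕ.* (k ∸ i)
    b≤2[k∸i] = subst (b ℕ.≤_) (sym (ℕ.*-distribˡ-∸ 2 k i)) (ℕ.m+n≤o⇒m≤o∸n b (ℕ.s≤s⁻¹ b+2i<1+2k))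

coeffOfShift : ℕ → ℕ → Series → ℤ
coeffOfShift k i q = if i ≤ᵇ k then q (k ∸ i) else 0ℤ

⊛-coeff-bounded : ∀ a (p q : Series) k → Deg≤ a p →
                  (p ⊛ q) k ≡ sumUpTo a (λ i → p i * coeffOfShift k i q)
⊛-coeff-bounded a p q k p≤a = begin
  sumUpTo k (λ i → p i * q (k ∸ i))
    ≡⟨ sumUpTo-cong k (λ i i≤k → cong (p i *_) (sym (if-≤ᵇ-true i≤k))) ⟩
  sumUpTo k term
    ≡⟨ sumUpTo-extend term (ℕ.m≤m⊔n k a) beyond-k ⟨
  sumUpTo (k ⊔ a) term
    ≡⟨ sumUpTo-extend term (ℕ.m≤n⊔m k a) beyond-a ⟩
  sumUpTo a term ∎
  where
  open ≡-Reasoning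
  term : ℕ → ℤ
  term i = p i * coeffOfShift k i q
  beyond-k : ∀ i → k ℕ.< i → term i ≡ 0ℤ
  beyond-k i k<i = trans (cong (p i *_) (if-≤ᵇ-false (ℕ.<⇒≱ k<i))) (ℤ.*-zeroʳ (p i))
  beyond-a : ∀ i → a ℕ.< i → term i ≡ 0ℤ
  beyond-a i a<i = trans (cong (_* coeffOfShift k i q) (p≤a i a<i)) (ℤ.*-zeroˡ (coeffOfShift k i q))

private
  <⇒∃+suc : ∀ {m n} → m ℕ.< n → Σ ℕ λ d → n ≡ m ℕ.+ suc d
  <⇒∃+suc {m} m<n with ℕ.m≤n⇒∃[o]m+o≡n m<n
  ... | d , refl = d , sym (ℕ.+-suc m d)

coeffOfShift-revS : ∀ (q : Series) i j b k → Deg≤ b q → k ℕ.≤ (i ℕ.+ j) ℕ.+ b →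
                    coeffOfShift ((i ℕ.+ j) ℕ.+ b ∸ k) i q ≡ coeffOfShift k j (revS b q)
coeffOfShift-revS q i j b k q≤b k≤ with j ℕ.≤? k
... | yes j≤k with ℕ.m≤n⇒∃[o]m+o≡n j≤k
...   | l , refl with l ℕ.≤? b
...     | yes l≤b with ℕ.m≤n⇒∃[o]m+o≡n l≤b
...       | c , refl = begin
  coeffOfShift ((i ℕ.+ j) ℕ.+ (l ℕ.+ c) ∸ (j ℕ.+ l)) i q
    ≡⟨ cong (λ m → coeffOfShift m i q) j+l-cancels ⟩
  coeffOfShift (i ℕ.+ c) i q          ≡⟨ if-≤ᵇ-true (ℕ.m≤m+n i c) ⟩
  q (i ℕ.+ c ∸ i)                     ≡⟨ cong q (ℕ.m+n∸m≡n i c) ⟩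
  q c                                 ≡⟨ cong q (ℕ.m+n∸m≡n l c) ⟨
  q (l ℕ.+ c ∸ l)                     ≡⟨ if-≤ᵇ-true (ℕ.m≤m+n l c) ⟨
  revS (l ℕ.+ c) q l                  ≡⟨ cong (revS (l ℕ.+ c) q) (ℕ.m+n∸m≡n j l) ⟨
  revS (l ℕ.+ c) q (j ℕ.+ l ∸ j)      ≡⟨ if-≤ᵇ-true (ℕ.m≤m+n j l) ⟨
  coeffOfShift (j ℕ.+ l) j (revS (l ℕ.+ c) q) ∎
  where
  open ≡-Reasoning
  j+l-cancels : (i ℕ.+ j) ℕ.+ (l ℕ.+ c) ∸ (j ℕ.+ l) ≡ i ℕ.+ c
  j+l-cancels = trans (cong (_∸ (j ℕ.+ l)) (rearrange i j l c)) (ℕ.m+n∸m≡n (j ℕ.+ l) (i ℕ.+ c))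
    where
    rearrange : ∀ i j l c → (i ℕ.+ j) ℕ.+ (l ℕ.+ c) ≡ (j ℕ.+ l) ℕ.+ (i ℕ.+ c)
    rearrange = ℕ-Solver.solve-∀
coeffOfShift-revS q i j b k q≤b k≤ | yes j≤k | l , refl | no l≰b with <⇒∃+suc (ℕ.≰⇒> l≰b)
... | c , refl =
  trans (if-≤ᵇ-false i≰) (sym (trans (if-≤ᵇ-true (ℕ.m≤m+n j (b ℕ.+ suc c)))
                               (trans (cong (revS b q) (ℕ.m+n∸m≡n j (b ℕ.+ suc c))) (if-≤ᵇ-false l≰b))))
  where
  reassoc₁ : ∀ i j b → (i ℕ.+ j) ℕ.+ b ≡ (j ℕ.+ b) ℕ.+ i
  reassoc₁ = ℕ-Solver.solve-∀
  reassoc₂ : ∀ j b c → j ℕ.+ (b ℕ.+ suc c) ≡ (j ℕ.+ b) ℕ.+ suc c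
  reassoc₂ = ℕ-Solver.solve-∀
  difference : (i ℕ.+ j) ℕ.+ b ∸ (j ℕ.+ (b ℕ.+ suc c)) ≡ i ∸ suc c
  difference = trans (cong₂ _∸_ (reassoc₁ i j b) (reassoc₂ j b c))
                     (ℕ.[m+n]∸[m+o]≡n∸o (j ℕ.+ b) i (suc c))
  1+c≤i : suc c ℕ.≤ i
  1+c≤i = ℕ.+-cancelˡ-≤ (j ℕ.+ b) (suc c) i (subst₂ ℕ._≤_ (reassoc₂ j b c) (reassoc₁ i j b) k≤)
  i≰ : ¬ i ℕ.≤ (i ℕ.+ j) ℕ.+ b ∸ (j ℕ.+ (b ℕ.+ suc c))
  i≰ i≤ = ℕ.<⇒≱ (ℕ.∸-monoʳ-< {i} {suc c} {0} (s≤s z≤n) 1+c≤i) (subst (i ℕ.≤_) difference i≤)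
coeffOfShift-revS q i j b k q≤b k≤ | no j≰k with <⇒∃+suc (ℕ.≰⇒> j≰k)
...   | d , refl = begin
  coeffOfShift ((i ℕ.+ (k ℕ.+ suc d)) ℕ.+ b ∸ k) i q
    ≡⟨ cong (λ m → coeffOfShift m i q) k-cancels ⟩
  coeffOfShift (i ℕ.+ (suc d ℕ.+ b)) i q
    ≡⟨ if-≤ᵇ-true (ℕ.m≤m+n i (suc d ℕ.+ b)) ⟩
  q (i ℕ.+ (suc d ℕ.+ b) ∸ i)
    ≡⟨ cong q (ℕ.m+n∸m≡n i (suc d ℕ.+ b)) ⟩
  q (suc d ℕ.+ b)
    ≡⟨ q≤b (suc d ℕ.+ b) (s≤s (ℕ.m≤n+m b d)) ⟩
  0ℤ
    ≡⟨ if-≤ᵇ-false j≰k ⟨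
  coeffOfShift k (k ℕ.+ suc d) (revS b q) ∎
  where
  open ≡-Reasoning
  k-cancels : (i ℕ.+ (k ℕ.+ suc d)) ℕ.+ b ∸ k ≡ i ℕ.+ (suc d ℕ.+ b)
  k-cancels = trans (cong (_∸ k) (rearrange i k d b)) (ℕ.m+n∸m≡n k (i ℕ.+ (suc d ℕ.+ b)))
    where
    rearrange : ∀ i k d b → (i ℕ.+ (k ℕ.+ suc d)) ℕ.+ b ≡ k ℕ.+ (i ℕ.+ (suc d ℕ.+ b))
    rearrange = ℕ-Solver.solve-∀

revS-⊛ : ∀ a b (p q : Series) → Deg≤ a p → Deg≤ b q →
         revS (a ℕ.+ b) (p ⊛ q) ≈ₛ (revS a p ⊛ revS b q)
revS-⊛ a b p q p≤a q≤b k = trans lhs (sym rhs)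
  where
  Σ-form : ℤ
  Σ-form = sumUpTo a (λ i → p i * coeffOfShift k (a ∸ i) (revS b q))

  rhs : (revS a p ⊛ revS b q) k ≡ Σ-form
  rhs = begin
    (revS a p ⊛ revS b q) k
      ≡⟨ ⊛-coeff-bounded a (revS a p) (revS b q) k (Deg≤-revS a p) ⟩
    sumUpTo a (λ i → revS a p i * coeffOfShift k i (revS b q))
      ≡⟨ sumUpTo-cong a (λ i i≤a → cong (_* coeffOfShift k i (revS b q)) (if-≤ᵇ-true i≤a)) ⟩
    sumUpTo a (λ i → p (a ∸ i) * coeffOfShift k i (revS b q))
      ≡⟨ sumUpTo-reverse a _ ⟩
    sumUpTo a (λ i → p (a ∸ (a ∸ i)) * coeffOfShift k (a ∸ i) (revS b q))
      ≡⟨ sumUpTo-cong a (λ i i≤a → cong (λ u → p u * coeffOfShift k (a ∸ i) (revS b q)) (ℕ.m∸[m∸n]≡n i≤a)) ⟩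
    Σ-form ∎
    where open ≡-Reasoning

  termwise : k ℕ.≤ a ℕ.+ b → ∀ i → i ℕ.≤ a →
             coeffOfShift (a ℕ.+ b ∸ k) i q ≡ coeffOfShift k (a ∸ i) (revS b q)
  termwise k≤ i i≤a =
    subst (λ a′ → k ℕ.≤ a′ ℕ.+ b → coeffOfShift (a′ ℕ.+ b ∸ k) i q ≡ coeffOfShift k (a ∸ i) (revS b q))
          (ℕ.m+[n∸m]≡n i≤a) (coeffOfShift-revS q i (a ∸ i) b k q≤b) k≤

  vanishes : ¬ k ℕ.≤ a ℕ.+ b → ∀ i → i ℕ.≤ a → coeffOfShift k (a ∸ i) (revS b q) ≡ 0ℤ
  vanishes k≰ i i≤a =
    trans (if-≤ᵇ-true (ℕ.≤-trans (ℕ.m∸n≤m a i) (ℕ.≤-trans (ℕ.m≤m+n a b) (ℕ.<⇒≤ (ℕ.≰⇒> k≰)))))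
          (if-≤ᵇ-false (ℕ.<⇒≱ (ℕ.≤-trans b<k∸a (ℕ.∸-monoʳ-≤ k (ℕ.m∸n≤m a i)))))
    where
    b<k∸a : b ℕ.< k ∸ a
    b<k∸a = ℕ.m+n≤o⇒m≤o∸n (suc b) (subst (ℕ._≤ k) (cong suc (ℕ.+-comm a b)) (ℕ.≰⇒> k≰))

  lhs : revS (a ℕ.+ b) (p ⊛ q) k ≡ Σ-form
  lhs with k ℕ.≤? a ℕ.+ b
  ... | yes k≤ = trans (if-≤ᵇ-true k≤) (trans (⊛-coeff-bounded a p q (a ℕ.+ b ∸ k) p≤a)
                   (sumUpTo-cong a (λ i i≤a → cong (p i *_) (termwise k≤ i i≤a))))
  ... | no k≰ = trans (if-≤ᵇ-false k≰)
                  (sym (sumUpTo-zero a (λ i i≤a → trans (cong (p i *_) (vanishes k≰ i i≤a)) (ℤ.*-zeroʳ (p i)))))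
palindromic-Deg<½⇒zero : ∀ n (p : Series) → Deg<½ n p → revS n p ≈ₛ p → p ≈ₛ zeroS
palindromic-Deg<½⇒zero n p p<n rev≈ i with n ℕ.≤? 2 ℕ.* i
... | yes n≤2i = p<n i n≤2i
... | no  n≰2i = trans (sym (rev≈ i)) (trans (if-≤ᵇ-true i≤n) (p<n (n ∸ i) n≤2[n∸i]))
  where
  2i≤n : 2 ℕ.* i ℕ.≤ n
  2i≤n = ℕ.<⇒≤ (ℕ.≰⇒> n≰2i)
  i≤n : i ℕ.≤ n
  i≤n = ℕ.≤-trans (ℕ.m≤m+n i (i ℕ.+ 0)) 2i≤n
  n≤2[n∸i] : n ℕ.≤ 2 ℕ.* (n ∸ i)
  n≤2[n∸i] = subst (n ℕ.≤_) (sym (ℕ.*-distribˡ-∸ 2 n i))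
    (ℕ.m+n≤o⇒m≤o∸n n (subst (n ℕ.+ 2 ℕ.* i ℕ.≤_) (double n) (ℕ.+-monoʳ-≤ n 2i≤n)))
    where
    double : ∀ n → n ℕ.+ n ≡ 2 ℕ.* n
    double = ℕ-Solver.solve-∀

lowerHalf : ℕ → Series → Series
lowerHalf n q k = if suc (2 ℕ.* k) ≤ᵇ n then q k else 0ℤ

Deg≤-lowerHalf : ∀ n q → Deg≤ n (lowerHalf n q)
Deg≤-lowerHalf n q k n<k =
  if-≤ᵇ-false (λ 1+2k≤n → ℕ.<⇒≱ n<k (ℕ.≤-trans (ℕ.m≤m+n k (k ℕ.+ 0)) (ℕ.<⇒≤ 1+2k≤n)))

Deg<½-lowerHalf : ∀ n q → Deg<½ n (lowerHalf n q)
Deg<½-lowerHalf n q k n≤2k = if-≤ᵇ-false (λ 1+2k≤n → ℕ.<⇒≱ 1+2k≤n n≤2k)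

lowerHalf-zero : ∀ n {q} → q ≈ₛ zeroS → lowerHalf n q ≈ₛ zeroS
lowerHalf-zero n q≈0 k with suc (2 ℕ.* k) ≤ᵇ n
... | true  = q≈0 k
... | false = refl

antipalindromic-from-lowerHalf : ∀ n (q : Series) → Deg≤ n q → revS n q ≈ₛ negS q →
                            ∀ k → lowerHalf n q k - revS n (lowerHalf n q) k ≡ q k
antipalindromic-from-lowerHalf n q q≤n rev≈- k with k ℕ.≤? n
... | no k≰n =
  trans (cong₂ _-_ (if-≤ᵇ-false (λ 1+2k≤n → k≰n (ℕ.≤-trans (ℕ.m≤m+n k (k ℕ.+ 0)) (ℕ.<⇒≤ 1+2k≤n))))
                   (if-≤ᵇ-false k≰n))
        (sym (q≤n k (ℕ.≰⇒> k≰n)))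
... | yes k≤n with ℕ.m≤n⇒∃[o]m+o≡n k≤n
...   | j , refl = trans (cong (λ u → lowerHalf (k ℕ.+ j) q k - u) rev-at-k) by-cases
  where
  rev-at-k : revS (k ℕ.+ j) (lowerHalf (k ℕ.+ j) q) k ≡ lowerHalf (k ℕ.+ j) q j
  rev-at-k = trans (if-≤ᵇ-true k≤n) (cong (lowerHalf (k ℕ.+ j) q) (ℕ.m+n∸m≡n k j))
  qj≡-qk : q j ≡ - q k
  qj≡-qk = trans (sym (trans (if-≤ᵇ-true k≤n) (cong q (ℕ.m+n∸m≡n k j)))) (rev≈- k)
  lowerHalf-at-j : lowerHalf (k ℕ.+ j) q j ≡ (if suc (2 ℕ.* j) ≤ᵇ j ℕ.+ k then q j else 0ℤ)
  lowerHalf-at-j = cong (λ m → if suc (2 ℕ.* j) ≤ᵇ m then q j else 0ℤ) (ℕ.+-comm k j)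
  1+2k≡k+1+k : ∀ k → suc (2 ℕ.* k) ≡ k ℕ.+ suc k
  1+2k≡k+1+k = ℕ-Solver.solve-∀
  below : ∀ k j → k ℕ.< j → suc (2 ℕ.* k) ℕ.≤ k ℕ.+ j
  below k j k<j = subst (ℕ._≤ k ℕ.+ j) (sym (1+2k≡k+1+k k)) (ℕ.+-monoʳ-≤ k k<j)
  not-below : ∀ k j → j ℕ.≤ k → ¬ suc (2 ℕ.* k) ℕ.≤ k ℕ.+ j
  not-below k j j≤k le = ℕ.<⇒≱ (ℕ.+-cancelˡ-≤ k (suc k) j (subst (ℕ._≤ k ℕ.+ j) (1+2k≡k+1+k k) le)) j≤k
  x≡-x⇒x≡0 : ∀ (x : ℤ) → x ≡ - x → x ≡ 0ℤ
  x≡-x⇒x≡0 x x≡-x = ℤ.*-cancelˡ-≡ (ℤ.+ 2) x 0ℤ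
    (trans (two-x x) (trans (cong (x +_) x≡-x) (ℤ.+-inverseʳ x)))
    where
    two-x : ∀ x → ℤ.+ 2 * x ≡ x + x
    two-x = solve-∀
  by-cases : lowerHalf (k ℕ.+ j) q k - lowerHalf (k ℕ.+ j) q j ≡ q k
  by-cases with ℕ.<-cmp k j
  ... | tri< k<j _ _ =
    trans (cong₂ _-_ (if-≤ᵇ-true (below k j k<j))
                     (trans lowerHalf-at-j (if-≤ᵇ-false (not-below j k (ℕ.<⇒≤ k<j)))))
          (ℤ.+-identityʳ (q k))
  ... | tri> _ _ j<k =
    trans (cong₂ _-_ (if-≤ᵇ-false (not-below k j (ℕ.<⇒≤ j<k)))
                     (trans lowerHalf-at-j (if-≤ᵇ-true (below j k j<k))))
          (trans (cong (λ u → 0ℤ - u) qj≡-qk) (trans (ℤ.+-identityˡ _) (ℤ.neg-involutive (q k))))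
  ... | tri≈ _ refl _ =
    trans (cong₂ _-_ (if-≤ᵇ-false (not-below k k ℕ.≤-refl))
                     (trans lowerHalf-at-j (if-≤ᵇ-false (not-below k k ℕ.≤-refl))))
          (sym (x≡-x⇒x≡0 (q k) qj≡-qk))

ifS : Bool → Series → Series
ifS b s = if b then s else zeroS

ifZ : Bool → ℤ → ℤ
ifZ b x = if b then x else 0ℤ

ifS-cong : ∀ b {s t} → (b ≡ true → s ≈ₛ t) → ifS b s ≈ₛ ifS b t
ifS-cong true  s≈t = s≈t refl
ifS-cong false s≈t = ≈ₛ-refl

ifS-true : ∀ {b} s → b ≡ true → ifS b s ≈ₛ s
ifS-true s refl = ≈ₛ-refl

ifS-zero : ∀ b {s} → (b ≡ true → s ≈ₛ zeroS) → ifS b s ≈ₛ zeroS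
ifS-zero true  s≈0 = s≈0 refl
ifS-zero false s≈0 = ≈ₛ-refl

ifS-∧ : ∀ b c s → ifS b (ifS c s) ≈ₛ ifS (b ∧ c) s
ifS-∧ true  c s = ≈ₛ-refl
ifS-∧ false c s = ≈ₛ-refl

ifS-⊛ : ∀ b s t → (ifS b s ⊛ t) ≈ₛ ifS b (s ⊛ t)
ifS-⊛ true  s t = ≈ₛ-refl
ifS-⊛ false s t = ⊛-zeroˡ t

⊛-ifS : ∀ b s t → (t ⊛ ifS b s) ≈ₛ ifS b (t ⊛ s)
⊛-ifS true  s t = ≈ₛ-refl
⊛-ifS false s t = ⊛-zeroʳ t

ifS-⊕ : ∀ b s t → (ifS b s ⊕ ifS b t) ≈ₛ ifS b (s ⊕ t)
ifS-⊕ true  s t = ≈ₛ-refl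
ifS-⊕ false s t i = refl

ifS-negS : ∀ b s → negS (ifS b s) ≈ₛ ifS b (negS s)
ifS-negS true  s = ≈ₛ-refl
ifS-negS false s i = refl

ifS-scaleS : ∀ b c s → scaleS c (ifS b s) ≈ₛ ifS b (scaleS c s)
ifS-scaleS true  c s = ≈ₛ-refl
ifS-scaleS false c s = scaleS-zero c

ifS-scaleS-coeff : ∀ b c s k → ifS b (scaleS c s) k ≡ ifZ b c * s k
ifS-scaleS-coeff true  c s k = refl
ifS-scaleS-coeff false c s k = sym (ℤ.*-zeroˡ (s k))

ifZ-cong : ∀ b {x y} → (b ≡ true → x ≡ y) → ifZ b x ≡ ifZ b y
ifZ-cong true  x≡y = x≡y refl
ifZ-cong false x≡y = refl

ifZ-*ˡ : ∀ b c x → ifZ b (c * x) ≡ c * ifZ b x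
ifZ-*ˡ true  c x = refl
ifZ-*ˡ false c x = sym (ℤ.*-zeroʳ c)

ifZ-neg : ∀ b x → ifZ b (- x) ≡ - ifZ b x
ifZ-neg true  x = refl
ifZ-neg false x = refl

Deg≤-ifS : ∀ n b s → (b ≡ true → Deg≤ n s) → Deg≤ n (ifS b s)
Deg≤-ifS n true  s s≤n = s≤n refl
Deg≤-ifS n false s s≤n i _ = refl

Deg<½-ifS : ∀ n b s → (b ≡ true → Deg<½ n s) → Deg<½ n (ifS b s)
Deg<½-ifS n true  s s<n = s<n refl
Deg<½-ifS n false s s<n i _ = refl

sumFinS-cong : ∀ n {F G : Fin n → Series} → (∀ w → F w ≈ₛ G w) → sumFinS n F ≈ₛ sumFinS n G
sumFinS-cong n F≈G k = sumFin-cong n (λ w → F≈G w k)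

sumFinS-⊕ : ∀ n (F G : Fin n → Series) → sumFinS n (λ w → F w ⊕ G w) ≈ₛ (sumFinS n F ⊕ sumFinS n G)
sumFinS-⊕ n F G k = sumFin-+ n (λ w → F w k) (λ w → G w k)

sumFinS-scaleS : ∀ n c (F : Fin n → Series) → sumFinS n (λ w → scaleS c (F w)) ≈ₛ scaleS c (sumFinS n F)
sumFinS-scaleS n c F k = sumFin-*ˡ n c (λ w → F w k)

sumFinS-negS : ∀ n (F : Fin n → Series) → sumFinS n (λ w → negS (F w)) ≈ₛ negS (sumFinS n F)
sumFinS-negS n F k = sumFin-neg n (λ w → F w k)

sumFinS-zero : ∀ n {F : Fin n → Series} → (∀ w → F w ≈ₛ zeroS) → sumFinS n F ≈ₛ zeroS
sumFinS-zero n F≈0 k = sumFin-zero n (λ w → F≈0 w k)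

sumFinS-comm : ∀ n m (F : Fin n → Fin m → Series) →
               sumFinS n (λ a → sumFinS m (F a)) ≈ₛ sumFinS m (λ b → sumFinS n (λ a → F a b))
sumFinS-comm n m F k = sumFin-comm n m (λ a b → F a b k)

sumFinS-select : ∀ n (F : Fin n → Series) (a : Fin n) → (∀ w → w ≢ a → F w ≈ₛ zeroS) →
                 sumFinS n F ≈ₛ F a
sumFinS-select n F a F≈0 k = sumFin-select n (λ w → F w k) a (λ w w≢a → F≈0 w w≢a k)

ifS-sumFinS : ∀ b n (F : Fin n → Series) → ifS b (sumFinS n F) ≈ₛ sumFinS n (λ w → ifS b (F w))
ifS-sumFinS true  n F = ≈ₛ-refl
ifS-sumFinS false n F = ≈ₛ-sym (sumFinS-zero n (λ w → ≈ₛ-refl))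

sumFinS-⊛ : ∀ n (F : Fin n → Series) s → (sumFinS n F ⊛ s) ≈ₛ sumFinS n (λ w → F w ⊛ s)
sumFinS-⊛ n F s k = begin
  sumUpTo k (λ i → sumFin n (λ w → F w i) * s (k ∸ i))
    ≡⟨ sumUpTo-cong k (λ i _ → ℤ.*-comm _ (s (k ∸ i))) ⟩
  sumUpTo k (λ i → s (k ∸ i) * sumFin n (λ w → F w i))
    ≡⟨ sumUpTo-cong k (λ i _ → sumFin-*ˡ n (s (k ∸ i)) (λ w → F w i)) ⟨
  sumUpTo k (λ i → sumFin n (λ w → s (k ∸ i) * F w i))
    ≡⟨ sumUpTo-cong k (λ i _ → sumFin-cong n (λ w → ℤ.*-comm (s (k ∸ i)) (F w i))) ⟩
  sumUpTo k (λ i → sumFin n (λ w → F w i * s (k ∸ i)))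
    ≡⟨ sumFin-sumUpTo-comm n k (λ w i → F w i * s (k ∸ i)) ⟨
  sumFin n (λ w → (F w ⊛ s) k) ∎
  where open ≡-Reasoning

⊛-sumFinS : ∀ n (F : Fin n → Series) s → (s ⊛ sumFinS n F) ≈ₛ sumFinS n (λ w → s ⊛ F w)
⊛-sumFinS n F s k =
  trans (sumUpTo-cong k (λ i _ → sym (sumFin-*ˡ n (s i) (λ w → F w (k ∸ i)))))
        (sym (sumFin-sumUpTo-comm n k (λ w i → s i * F w (k ∸ i))))

Deg≤-sumFinS : ∀ n a (F : Fin n → Series) → (∀ w → Deg≤ a (F w)) → Deg≤ a (sumFinS n F)
Deg≤-sumFinS n a F F≤a i a<i = sumFin-zero n (λ w → F≤a w i a<i)

Deg<½-sumFinS : ∀ n a (F : Fin n → Series) → (∀ w → Deg<½ a (F w)) → Deg<½ a (sumFinS n F)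
Deg<½-sumFinS n a F F<a i a≤2i = sumFin-zero n (λ w → F<a w i a≤2i)

revS-cong : ∀ m {s t} → s ≈ₛ t → revS m s ≈ₛ revS m t
revS-cong m s≈t k with k ≤ᵇ m
... | true  = s≈t (m ∸ k)
... | false = refl

revS-zero : ∀ m → revS m zeroS ≈ₛ zeroS
revS-zero m k with k ≤ᵇ m
... | true  = refl
... | false = refl

revS-⊕ : ∀ m s t → revS m (s ⊕ t) ≈ₛ (revS m s ⊕ revS m t)
revS-⊕ m s t k with k ≤ᵇ m
... | true  = refl
... | false = refl

revS-negS : ∀ m s → revS m (negS s) ≈ₛ negS (revS m s)
revS-negS m s k with k ≤ᵇ m
... | true  = refl
... | false = refl

revS-scaleS : ∀ m c s → revS m (scaleS c s) ≈ₛ scaleS c (revS m s)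
revS-scaleS m c s k with k ≤ᵇ m
... | true  = refl
... | false = sym (ℤ.*-zeroʳ c)

revS-ifS : ∀ m b s → revS m (ifS b s) ≈ₛ ifS b (revS m s)
revS-ifS m true  s = ≈ₛ-refl
revS-ifS m false s = revS-zero m

revS-sumFinS : ∀ m n (F : Fin n → Series) → revS m (sumFinS n F) ≈ₛ sumFinS n (λ w → revS m (F w))
revS-sumFinS m n F k with k ≤ᵇ m
... | true  = refl
... | false = sym (sumFin-zero n (λ w → refl))

sgn-+ : ∀ m n → sgn (m ℕ.+ n) ≡ sgn m * sgn n
sgn-+ m n = ℤ.^-distribˡ-+-* -1ℤ m n

sgn-suc : ∀ n → sgn (suc n) ≡ - sgn n
sgn-suc n = ℤ.-1*i≡-i (sgn n)

sgn*sgn : ∀ n → sgn n * sgn n ≡ 1ℤ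
sgn*sgn zero    = refl
sgn*sgn (suc n) = trans (square-neg (sgn n)) (sgn*sgn n)
  where
  square-neg : ∀ s → (-1ℤ * s) * (-1ℤ * s) ≡ s * s
  square-neg = solve-∀

sgn-∸ : ∀ {m n} → n ℕ.≤ m → sgn (m ∸ n) ≡ sgn n * sgn m
sgn-∸ {m} {n} n≤m = begin
  sgn (m ∸ n)                          ≡⟨ ℤ.*-identityˡ _ ⟨
  1ℤ * sgn (m ∸ n)                     ≡⟨ cong (_* sgn (m ∸ n)) (sgn*sgn n) ⟨
  (sgn n * sgn n) * sgn (m ∸ n)        ≡⟨ ℤ.*-assoc (sgn n) _ _ ⟩
  sgn n * (sgn n * sgn (m ∸ n))        ≡⟨ cong (sgn n *_) (sgn-+ n (m ∸ n)) ⟨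
  sgn n * sgn (n ℕ.+ (m ∸ n))          ≡⟨ cong (λ k → sgn n * sgn k) (ℕ.m+[n∸m]≡n n≤m) ⟩
  sgn n * sgn m                        ∎
  where open ≡-Reasoning

sumFinS-ifS-scaleS : ∀ n (P : Fin n → Bool) (c : Fin n → ℤ) s →
  sumFinS n (λ w → ifS (P w) (scaleS (c w) s)) ≈ₛ scaleS (sumFin n (λ w → ifZ (P w) (c w))) s
sumFinS-ifS-scaleS n P c s k = begin
  sumFin n (λ w → ifS (P w) (scaleS (c w) s) k)  ≡⟨ sumFin-cong n (λ w → ifS-scaleS-coeff (P w) (c w) s k) ⟩
  sumFin n (λ w → ifZ (P w) (c w) * s k)          ≡⟨ sumFin-cong n (λ w → ℤ.*-comm _ (s k)) ⟩
  sumFin n (λ w → s k * ifZ (P w) (c w))          ≡⟨ sumFin-*ˡ n (s k) _ ⟩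
  s k * sumFin n (λ w → ifZ (P w) (c w))          ≡⟨ ℤ.*-comm (s k) _ ⟩
  sumFin n (λ w → ifZ (P w) (c w)) * s k          ∎
  where open ≡-Reasoning

-- Incidence algebras

module Intervals (B : FinOrd) where

  open FinOrd B using (_≤_; _≤?_)

  inInt-true : ∀ {z w z′} → z ≤ w → w ≤ z′ → inInt B z w z′ ≡ true
  inInt-true {z} {w} {z′} z≤w w≤z′ with z ≤? w | w ≤? z′
  ... | yes _ | yes _   = refl
  ... | no z≰w | _      = ⊥-elim (z≰w z≤w)
  ... | yes _ | no w≰z′ = ⊥-elim (w≰z′ w≤z′)

  inInt⇒≤ : ∀ {z w z′} → inInt B z w z′ ≡ true → z ≤ w × w ≤ z′
  inInt⇒≤ {z} {w} {z′} _ with z ≤? w | w ≤? z′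
  inInt⇒≤ _  | yes z≤w | yes w≤z′ = z≤w , w≤z′
  inInt⇒≤ () | yes _   | no _
  inInt⇒≤ () | no _    | _

  inInt-false : ∀ {z w z′} → ¬ (z ≤ w × w ≤ z′) → inInt B z w z′ ≡ false
  inInt-false {z} {w} {z′} ∉ with inInt B z w z′ in e
  ... | true  = ⊥-elim (∉ (inInt⇒≤ e))
  ... | false = refl

module IncidenceAlgebra (B : FinOrd) (B-po : IsPartialOrder _≡_ (FinOrd._≤_ B)) where

  open FinOrd B using (size; _≤_; _≤?_)
  open IsPartialOrder B-po using () renaming (refl to ≤-refl; trans to ≤-trans; antisym to ≤-antisym)
  open Intervals B

  infixl 7 _·_
  _·_ : Inc B → Inc B → Inc B
  _·_ = mul B

  infix 4 _≈ᴵ_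
  _≈ᴵ_ : Inc B → Inc B → Set
  _≈ᴵ_ = EqI B

  ≈ᴵ-setoid : Setoid 0ℓ 0ℓ
  ≈ᴵ-setoid = record
    { Carrier = Inc B ; _≈_ = _≈ᴵ_
    ; isEquivalence = record
      { refl  = λ _ _ _ → ≈ₛ-refl
      ; sym   = λ p≈q z z′ z≤z′ → ≈ₛ-sym (p≈q z z′ z≤z′)
      ; trans = λ p≈q q≈s z z′ z≤z′ → ≈ₛ-trans (p≈q z z′ z≤z′) (q≈s z z′ z≤z′) } }

  module ≈ᴵ-Reasoning = SetoidReasoning ≈ᴵ-setoid
  open Setoid ≈ᴵ-setoid public using () renaming (refl to ≈ᴵ-refl; sym to ≈ᴵ-sym; trans to ≈ᴵ-trans)

  summand : Inc B → Inc B → Fin size → Fin size → Fin size → Series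
  summand p q z z′ w = ifS (inInt B z w z′) (p z w ⊛ q w z′)

  ≈ᴵ-pointwise : ∀ {p q} → (∀ z z′ → p z z′ ≈ₛ q z z′) → p ≈ᴵ q
  ≈ᴵ-pointwise p≈q z z′ _ = p≈q z z′

  -- Equalities in I(B) only constrain values on intervals, so each summand of a
  -- product may be rewritten under the hypothesis that w lies in [z, z′].
  mul-pointwise : ∀ {p q p′ q′} z z′ →
                  (∀ w → z ≤ w → w ≤ z′ → (p z w ⊛ q w z′) ≈ₛ (p′ z w ⊛ q′ w z′)) →
                  (p · q) z z′ ≈ₛ (p′ · q′) z z′
  mul-pointwise z z′ term≈ = sumFinS-cong size (λ w → ifS-cong (inInt B z w z′) (λ w∈ →
    term≈ w (proj₁ (inInt⇒≤ w∈)) (proj₂ (inInt⇒≤ w∈))))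

  mul-vanishes : ∀ p q z z′ → (∀ w → z ≤ w → w ≤ z′ → (p z w ⊛ q w z′) ≈ₛ zeroS) →
                 (p · q) z z′ ≈ₛ zeroS
  mul-vanishes p q z z′ term≈0 = sumFinS-zero size (λ w → ifS-zero (inInt B z w z′) (λ w∈ →
    term≈0 w (proj₁ (inInt⇒≤ w∈)) (proj₂ (inInt⇒≤ w∈))))

  ·-cong : ∀ {p p′ q q′} → p ≈ᴵ p′ → q ≈ᴵ q′ → p · q ≈ᴵ p′ · q′
  ·-cong {p} {p′} {q} {q′} p≈p′ q≈q′ z z′ _ =
    mul-pointwise {p} {q} {p′} {q′} z z′ (λ w z≤w w≤z′ → ⊛-cong (p≈p′ z w z≤w) (q≈q′ w z′ w≤z′))

  ·-congˡ : ∀ p {q q′} → q ≈ᴵ q′ → p · q ≈ᴵ p · q′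
  ·-congˡ p = ·-cong {p} (≈ᴵ-refl {p})

  ·-congʳ : ∀ {p p′} q → p ≈ᴵ p′ → p · q ≈ᴵ p′ · q
  ·-congʳ q p≈p′ = ·-cong p≈p′ (≈ᴵ-refl {q})

  ·-assoc : ∀ p q s → (p · q) · s ≈ᴵ p · (q · s)
  ·-assoc p q s z z′ _ = ≈ₛ-trans lhs (≈ₛ-sym rhs)
    where
    t : Fin size → Fin size → Series
    t u w = p z u ⊛ (q u w ⊛ s w z′)
    Iv : Fin size → Fin size → Fin size → Bool
    Iv = inInt B
    swap-intervals : ∀ u w → (Iv z w z′ ∧ Iv z u w) ≡ (Iv z u z′ ∧ Iv u w z′)
    swap-intervals u w = ≡true⇔⇒≡ ⇒ ⇐
      where
      ⇒ : Iv z w z′ ∧ Iv z u w ≡ true → Iv z u z′ ∧ Iv u w z′ ≡ true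
      ⇒ e with ∧≡true⁻ e
      ... | w∈ , u∈ with inInt⇒≤ w∈ | inInt⇒≤ u∈
      ... | _ , w≤z′ | z≤u , u≤w = ∧≡true⁺ (inInt-true z≤u (≤-trans u≤w w≤z′)) (inInt-true u≤w w≤z′)
      ⇐ : Iv z u z′ ∧ Iv u w z′ ≡ true → Iv z w z′ ∧ Iv z u w ≡ true
      ⇐ e with ∧≡true⁻ e
      ... | u∈ , w∈ with inInt⇒≤ u∈ | inInt⇒≤ w∈
      ... | z≤u , _ | u≤w , w≤z′ = ∧≡true⁺ (inInt-true (≤-trans z≤u u≤w) w≤z′) (inInt-true z≤u u≤w)
    lhs : ((p · q) · s) z z′ ≈ₛ sumFinS size (λ u → sumFinS size (λ w → ifS (Iv z u z′ ∧ Iv u w z′) (t u w)))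
    lhs = ≈ₛ-trans (sumFinS-cong size (λ w → ifS-cong (Iv z w z′) (λ _ →
            ≈ₛ-trans (sumFinS-⊛ size _ (s w z′)) (sumFinS-cong size (λ u → ifS-⊛ (Iv z u w) _ (s w z′))))))
          (≈ₛ-trans (sumFinS-cong size (λ w → ≈ₛ-trans (ifS-sumFinS (Iv z w z′) size _)
                                            (sumFinS-cong size (λ u → ifS-∧ (Iv z w z′) (Iv z u w) _))))
          (≈ₛ-trans (sumFinS-comm size size _)
          (sumFinS-cong size (λ u → sumFinS-cong size (λ w k →
            trans (cong (λ b → ifS b ((p z u ⊛ q u w) ⊛ s w z′) k) (swap-intervals u w))
                  (ifS-cong (Iv z u z′ ∧ Iv u w z′) (λ _ → ⊛-assoc (p z u) (q u w) (s w z′)) k))))))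
    rhs : (p · (q · s)) z z′ ≈ₛ sumFinS size (λ u → sumFinS size (λ w → ifS (Iv z u z′ ∧ Iv u w z′) (t u w)))
    rhs = ≈ₛ-trans (sumFinS-cong size (λ u → ifS-cong (Iv z u z′) (λ _ →
            ≈ₛ-trans (⊛-sumFinS size (λ w → ifS (Iv u w z′) (q u w ⊛ s w z′)) (p z u))
                     (sumFinS-cong size (λ w → ⊛-ifS (Iv u w z′) (q u w ⊛ s w z′) (p z u))))))
          (sumFinS-cong size (λ u → ≈ₛ-trans (ifS-sumFinS (Iv z u z′) size (λ w → ifS (Iv u w z′) (t u w)))
                                             (sumFinS-cong size (λ w → ifS-∧ (Iv z u z′) (Iv u w z′) (t u w)))))

  oneI-diag : ∀ z → oneI B z z ≈ₛ oneS
  oneI-diag z with z Fin.≟ z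
  ... | yes _   = ≈ₛ-refl
  ... | no z≢z = ⊥-elim (z≢z refl)

  oneI-off-diag : ∀ {z w} → z ≢ w → oneI B z w ≈ₛ zeroS
  oneI-off-diag {z} {w} z≢w with z Fin.≟ w
  ... | yes z≡w = ⊥-elim (z≢w z≡w)
  ... | no _    = ≈ₛ-refl

  mul-diag : ∀ p q z → (p · q) z z ≈ₛ (p z z ⊛ q z z)
  mul-diag p q z = ≈ₛ-trans
    (sumFinS-select size _ z (λ w w≢z → ifS-zero (inInt B z w z) (λ w∈ →
      ⊥-elim (w≢z (≤-antisym (proj₂ (inInt⇒≤ w∈)) (proj₁ (inInt⇒≤ w∈)))))))
    (ifS-true (p z z ⊛ q z z) (inInt-true ≤-refl ≤-refl))

  ·-identityˡ : ∀ p → oneI B · p ≈ᴵ p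
  ·-identityˡ p z z′ z≤z′ = ≈ₛ-trans
    (sumFinS-select size _ z (λ w w≢z → ifS-zero (inInt B z w z′) (λ _ →
      ≈ₛ-trans (⊛-congʳ (p w z′) (oneI-off-diag (w≢z ∘ sym))) (⊛-zeroˡ (p w z′)))))
    (≈ₛ-trans (ifS-true (oneI B z z ⊛ p z z′) (inInt-true ≤-refl z≤z′))
              (≈ₛ-trans (⊛-congʳ (p z z′) (oneI-diag z)) (⊛-identityˡ (p z z′))))

  ·-identityʳ : ∀ p → p · oneI B ≈ᴵ p
  ·-identityʳ p z z′ z≤z′ = ≈ₛ-trans
    (sumFinS-select size _ z′ (λ w w≢z′ → ifS-zero (inInt B z w z′) (λ _ →
      ≈ₛ-trans (⊛-congˡ (p z w) (oneI-off-diag w≢z′)) (⊛-zeroʳ (p z w)))))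
    (≈ₛ-trans (ifS-true (p z z′ ⊛ oneI B z′ z′) (inInt-true z≤z′ ≤-refl))
              (≈ₛ-trans (⊛-congˡ (p z z′) (oneI-diag z′)) (⊛-identityʳ (p z z′))))

  addI : Inc B → Inc B → Inc B
  addI p q z z′ = p z z′ ⊕ q z z′

  ·-distribˡ-addI : ∀ p q s z z′ → (p · addI q s) z z′ ≈ₛ ((p · q) z z′ ⊕ (p · s) z z′)
  ·-distribˡ-addI p q s z z′ = ≈ₛ-trans
    (sumFinS-cong size (λ w → ≈ₛ-trans (ifS-cong (inInt B z w z′) (λ _ → ⊛-distribˡ-⊕ (p z w) (q w z′) (s w z′)))
                                       (≈ₛ-sym (ifS-⊕ (inInt B z w z′) _ _))))
    (sumFinS-⊕ size _ _)

  ·-negIˡ : ∀ p q z z′ → (negI B p · q) z z′ ≈ₛ negS ((p · q) z z′)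
  ·-negIˡ p q z z′ = ≈ₛ-trans
    (sumFinS-cong size (λ w → ≈ₛ-trans (ifS-cong (inInt B z w z′) (λ _ → negS-⊛ (p z w) (q w z′)))
                                       (≈ₛ-sym (ifS-negS (inInt B z w z′) _))))
    (sumFinS-negS size _)

  ·-negIʳ : ∀ p q z z′ → (p · negI B q) z z′ ≈ₛ negS ((p · q) z z′)
  ·-negIʳ p q z z′ = ≈ₛ-trans
    (sumFinS-cong size (λ w → ≈ₛ-trans (ifS-cong (inInt B z w z′) (λ _ → ⊛-negS (p z w) (q w z′)))
                                       (≈ₛ-sym (ifS-negS (inInt B z w z′) _))))
    (sumFinS-negS size _)

  ·-difference : ∀ p q p′ q′ z z′ →
    ((p · q) z z′ ⊕ negS ((p′ · q′) z z′))
      ≈ₛ sumFinS size (λ w → ifS (inInt B z w z′) ((p z w ⊛ q w z′) ⊕ negS (p′ z w ⊛ q′ w z′)))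
  ·-difference p q p′ q′ z z′ =
    ≈ₛ-trans (⊕-cong (≈ₛ-refl {(p · q) z z′}) (≈ₛ-sym (sumFinS-negS size (summand p′ q′ z z′))))
    (≈ₛ-trans (≈ₛ-sym (sumFinS-⊕ size (summand p q z z′) (λ w → negS (summand p′ q′ z z′ w))))
      (sumFinS-cong size (λ w → ≈ₛ-trans (⊕-cong (≈ₛ-refl {summand p q z z′ w}) (ifS-negS (inInt B z w z′) _))
                                         (ifS-⊕ (inInt B z w z′) _ _))))

  negI-cong : ∀ {p q} → p ≈ᴵ q → negI B p ≈ᴵ negI B q
  negI-cong p≈q z z′ z≤z′ = negS-cong (p≈q z z′ z≤z′)

  ⊛-·ˡ : ∀ c p q z z′ → (c ⊛ (p · q) z z′) ≈ₛ ((λ a b → c ⊛ p a b) · q) z z′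
  ⊛-·ˡ c p q z z′ = ≈ₛ-trans (⊛-sumFinS size (summand p q z z′) c)
    (sumFinS-cong size (λ w → ≈ₛ-trans (⊛-ifS (inInt B z w z′) (p z w ⊛ q w z′) c)
      (ifS-cong (inInt B z w z′) (λ _ → ≈ₛ-sym (⊛-assoc c (p z w) (q w z′))))))

  module Ranked (r : Fin size → Fin size → ℕ) (r-weak : IsWeakRank B r) where

    r-additive : ∀ {z w z′} → z ≤ w → w ≤ z′ → r z z′ ≡ r z w ℕ.+ r w z′
    r-additive z≤w w≤z′ = proj₂ r-weak _ _ _ z≤w w≤z′

    r-diag : ∀ z → r z z ≡ 0
    r-diag z = ℕ.+-cancelˡ-≡ (r z z) (r z z) 0
      (trans (sym (r-additive ≤-refl ≤-refl)) (sym (ℕ.+-identityʳ (r z z))))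

    r-pos : ∀ {z z′} → _<_ B z z′ → 1 ℕ.≤ r z z′
    r-pos = proj₁ r-weak _ _

    rev-· : ∀ {p q} → InCalI B r p → InCalI B r q → rev B r (p · q) ≈ᴵ rev B r p · rev B r q
    rev-· {p} {q} p∈ q∈ z z′ _ = ≈ₛ-trans (revS-sumFinS (r z z′) size (summand p q z z′))
      (sumFinS-cong size (λ w → ≈ₛ-trans (revS-ifS (r z z′) (inInt B z w z′) (p z w ⊛ q w z′))
        (ifS-cong (inInt B z w z′) (λ w∈ → let (z≤w , w≤z′) = inInt⇒≤ w∈ in
          subst (λ m → revS m (p z w ⊛ q w z′) ≈ₛ (revS (r z w) (p z w) ⊛ revS (r w z′) (q w z′)))
                (sym (r-additive z≤w w≤z′))
                (revS-⊛ (r z w) (r w z′) (p z w) (q w z′) (p∈ z w z≤w) (q∈ w z′ w≤z′))))))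

    InCalI-· : ∀ {p q} → InCalI B r p → InCalI B r q → InCalI B r (p · q)
    InCalI-· {p} {q} p∈ q∈ z z′ _ =
      Deg≤-sumFinS size (r z z′) (summand p q z z′) (λ w → Deg≤-ifS (r z z′) (inInt B z w z′) _
      (λ w∈ → let (z≤w , w≤z′) = inInt⇒≤ w∈ in
        subst (λ m → Deg≤ m (p z w ⊛ q w z′)) (sym (r-additive z≤w w≤z′))
              (Deg≤-⊛ (r z w) (r w z′) (p∈ z w z≤w) (q∈ w z′ w≤z′))))

    -- The bound r ⊔ 1 lets the diagonal, where r vanishes, carry units and zeros.
    BelowHalfRank : Inc B → Set
    BelowHalfRank p = ∀ z w → z ≤ w → Deg<½ (r z w ⊔ 1) (p z w)

    BelowHalfRank-unit : ∀ {p} → InU B r p → (∀ z w → _<_ B z w → Deg<½ (r z w) (p z w)) → BelowHalfRank p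
    BelowHalfRank-unit {p} p-unit p-half z w z≤w with z Fin.≟ w
    ... | yes refl = subst (λ m → Deg<½ (m ⊔ 1) (p z z)) (sym (r-diag z)) (Deg<½-cong (≈ₛ-sym (p-unit z)) Deg<½-oneS)
    ... | no z≢w   = Deg<½-mono (ℕ.m≤m⊔n (r z w) 1) (p-half z w (z≤w , z≢w))

    BelowHalfRank-nil : ∀ {p} → (∀ z → p z z ≈ₛ zeroS) → (∀ z w → _<_ B z w → Deg<½ (r z w) (p z w)) → BelowHalfRank p
    BelowHalfRank-nil {p} p-nil p-half z w z≤w with z Fin.≟ w
    ... | yes refl = Deg<½-cong (≈ₛ-sym (p-nil z)) (Deg<½-zeroS _)
    ... | no z≢w   = Deg<½-mono (ℕ.m≤m⊔n (r z w) 1) (p-half z w (z≤w , z≢w))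

    Deg<½-· : ∀ {p q} → BelowHalfRank p → BelowHalfRank q → ∀ z z′ → _<_ B z z′ → Deg<½ (r z z′) ((p · q) z z′)
    Deg<½-· {p} {q} p½ q½ z z′ z<z′ =
      Deg<½-sumFinS size (r z z′) (summand p q z z′) (λ w → Deg<½-ifS (r z z′) (inInt B z w z′) _
      (λ w∈ → let (z≤w , w≤z′) = inInt⇒≤ w∈ in λ i r≤2i →
        Deg<½-⊛ (r z w ⊔ 1) (r w z′ ⊔ 1) (p½ z w z≤w) (q½ w z′ w≤z′) i
          (ℕ.≤-trans (⊔1-+ (r z w) (r w z′) (subst (1 ℕ.≤_) (r-additive z≤w w≤z′) (r-pos z<z′)))
                     (s≤s (subst (ℕ._≤ 2 ℕ.* i) (r-additive z≤w w≤z′) r≤2i)))))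
      where
      ⊔1-+ : ∀ a b → 1 ℕ.≤ a ℕ.+ b → (a ⊔ 1) ℕ.+ (b ⊔ 1) ℕ.≤ suc (a ℕ.+ b)
      ⊔1-+ zero    (suc b) _ rewrite ℕ.⊔-identityʳ b = ℕ.≤-refl
      ⊔1-+ (suc a) zero    _ rewrite ℕ.⊔-identityʳ a | ℕ.+-identityʳ a | ℕ.+-comm a 1 = ℕ.≤-refl
      ⊔1-+ (suc a) (suc b) _ rewrite ℕ.⊔-identityʳ a | ℕ.⊔-identityʳ b = ℕ.n≤1+n _

    Δ≈lowerHalf : ∀ p q {z z′} → _<_ B z z′ → (tMinus1 ⊛ p z z′) ≈ₛ negS q →
                  Δ B r p z z′ ≈ₛ lowerHalf (r z z′) q
    Δ≈lowerHalf p q {z} {z′} (z≤z′ , z≢z′) [t-1]p≈-q k with z Fin.≟ z′ | k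
    ... | yes z≡z′ | _ = ⊥-elim (z≢z′ z≡z′)
    ... | no _ | zero = sym (trans (if-≤ᵇ-true (r-pos (z≤z′ , z≢z′))) q₀)
      where
      q₀ : q 0 ≡ p z z′ 0
      q₀ = trans (sym (ℤ.neg-involutive (q 0)))
                 (trans (cong -_ (sym ([t-1]p≈-q 0)))
                        (trans (cong -_ (tMinus1-⊛-zero (p z z′))) (ℤ.neg-involutive _)))
    ... | no _ | suc i with suc i ℕ.≤? (r z z′ ∸ 1) / 2
    ...   | yes i<½ = trans (if-≤ᵇ-true i<½)
                        (sym (trans (if-≤ᵇ-true (/2-bound⇒ (suc i) (r z z′) (r-pos (z≤z′ , z≢z′)) i<½)) q₁₊ᵢ))
      where
      q₁₊ᵢ : q (suc i) ≡ p z z′ (suc i) - p z z′ i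
      q₁₊ᵢ = trans (sym (ℤ.neg-involutive (q (suc i))))
               (trans (cong -_ (sym ([t-1]p≈-q (suc i))))
               (trans (cong -_ (tMinus1-⊛-suc (p z z′) i)) (neg-difference (p z z′ i) (p z z′ (suc i)))))
        where
        neg-difference : ∀ u v → - (u - v) ≡ v - u
        neg-difference u v = trans (ℤ.neg-distrib-+ u (- v))
                               (trans (cong (- u +_) (ℤ.neg-involutive v)) (ℤ.+-comm (- u) v))
      /2-bound⇒ : ∀ m n → 1 ℕ.≤ n → m ℕ.≤ (n ∸ 1) / 2 → suc (2 ℕ.* m) ℕ.≤ n
      /2-bound⇒ m n 1≤n m≤ = subst (ℕ._≤ n) (ℕ.+-comm (2 ℕ.* m) 1)
        (ℕ.m≤o∸n⇒m+n≤o (2 ℕ.* m) 1≤n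
          (ℕ.≤-trans (subst (ℕ._≤ ((n ∸ 1) / 2) ℕ.* 2) (ℕ.*-comm m 2) (ℕ.*-monoˡ-≤ 2 m≤)) (m/n*n≤m (n ∸ 1) 2)))
    ...   | no i≮½ = trans (if-≤ᵇ-false i≮½) (sym (if-≤ᵇ-false (λ 1+2i≤r → i≮½ (/2-bound⇐ (suc i) (r z z′) 1+2i≤r))))
      where
      /2-bound⇐ : ∀ m n → suc (2 ℕ.* m) ℕ.≤ n → m ℕ.≤ (n ∸ 1) / 2
      /2-bound⇐ m n 1+2m≤n = subst (ℕ._≤ (n ∸ 1) / 2) (m*n/n≡m m 2)
        (/-monoˡ-≤ 2 (subst (ℕ._≤ n ∸ 1) (ℕ.*-comm 2 m)
          (ℕ.m+n≤o⇒m≤o∸n (2 ℕ.* m) (subst (ℕ._≤ n) (ℕ.+-comm 1 (2 ℕ.* m)) 1+2m≤n))))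

    Δ-diag : ∀ p z → Δ B r p z z ≈ₛ zeroS
    Δ-diag p z k with z Fin.≟ z
    ... | yes _   = refl
    ... | no z≢z = ⊥-elim (z≢z refl)

    module _ (p q : Inc B) (q≈[1-t]p : ∀ z z′ → z ≤ z′ → (tMinus1 ⊛ p z z′) ≈ₛ negS (q z z′)) where

      Δ∈𝓘 : InCalI B r (Δ B r p)
      Δ∈𝓘 z z′ z≤z′ = by-cases (z Fin.≟ z′)
        where
        by-cases : Dec (z ≡ z′) → Deg≤ (r z z′) (Δ B r p z z′)
        by-cases (yes refl) = Deg≤-cong (≈ₛ-sym (Δ-diag p z)) (λ _ _ → refl)
        by-cases (no z≢z′)  = Deg≤-cong (≈ₛ-sym (Δ≈lowerHalf p (q z z′) (z≤z′ , z≢z′) (q≈[1-t]p z z′ z≤z′)))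
                                        (Deg≤-lowerHalf (r z z′) (q z z′))

      Δ-below-half : BelowHalfRank (Δ B r p)
      Δ-below-half = BelowHalfRank-nil (Δ-diag p) (λ z z′ z<z′ →
        Deg<½-cong (≈ₛ-sym (Δ≈lowerHalf p (q z z′) z<z′ (q≈[1-t]p z z′ (proj₁ z<z′))))
                   (Deg<½-lowerHalf (r z z′) (q z z′)))

      rev-Δ : InCalI B r q → rev B r q ≈ᴵ negI B q → (∀ z → q z z ≈ₛ zeroS) →
              rev B r (Δ B r p) ≈ᴵ addI (Δ B r p) (negI B q)
      rev-Δ q∈𝓘 q-antipalindromic q-diag z z′ z≤z′ k =
        solve-for-rev (Δ B r p z z′ k) (revS (r z z′) (Δ B r p z z′) k) (q z z′ k) difference
        where
        solve-for-rev : ∀ d v c → d - v ≡ c → v ≡ d + - c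
        solve-for-rev d v c refl = rearrange d v
          where
          rearrange : ∀ d v → v ≡ d + - (d - v)
          rearrange = solve-∀
        difference : Δ B r p z z′ k - revS (r z z′) (Δ B r p z z′) k ≡ q z z′ k
        difference = by-cases (z Fin.≟ z′)
          where
          by-cases : Dec (z ≡ z′) → Δ B r p z z′ k - revS (r z z′) (Δ B r p z z′) k ≡ q z z′ k
          by-cases (yes refl) =
            trans (cong₂ _-_ (Δ-diag p z k) (trans (revS-cong (r z z) (Δ-diag p z) k) (revS-zero (r z z) k)))
                  (sym (q-diag z k))
          by-cases (no z≢z′) =
            trans (cong₂ _-_ (Δ≈lowerHalf p (q z z′) (z≤z′ , z≢z′) (q≈[1-t]p z z′ z≤z′) k)
                             (revS-cong (r z z′) (Δ≈lowerHalf p (q z z′) (z≤z′ , z≢z′) (q≈[1-t]p z z′ z≤z′)) k))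
                  (antipalindromic-from-lowerHalf (r z z′) (q z z′) (q∈𝓘 z z′ z≤z′) (q-antipalindromic z z′ z≤z′) k)

  module Signed (ρ : Fin size → ℕ) (ρ-mono : ∀ {z w} → z ≤ w → ρ z ℕ.≤ ρ w) where

    sign : Fin size → Fin size → ℤ
    sign z z′ = sgn (ρ z′ ∸ ρ z)

    ĥ : Inc B → Inc B
    ĥ = hat B ρ

    sign-split : ∀ {z w z′} → z ≤ w → w ≤ z′ → sign z z′ ≡ sign z w * sign w z′
    sign-split {z} {w} {z′} z≤w w≤z′ = begin
      sgn (ρ z′ ∸ ρ z)                              ≡⟨ cong (λ m → sgn (m ∸ ρ z)) (ℕ.m∸n+n≡m (ρ-mono w≤z′)) ⟨
      sgn ((ρ z′ ∸ ρ w ℕ.+ ρ w) ∸ ρ z)              ≡⟨ cong sgn (ℕ.+-∸-assoc (ρ z′ ∸ ρ w) (ρ-mono z≤w)) ⟩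
      sgn ((ρ z′ ∸ ρ w) ℕ.+ (ρ w ∸ ρ z))            ≡⟨ cong sgn (ℕ.+-comm (ρ z′ ∸ ρ w) (ρ w ∸ ρ z)) ⟩
      sgn ((ρ w ∸ ρ z) ℕ.+ (ρ z′ ∸ ρ w))            ≡⟨ sgn-+ (ρ w ∸ ρ z) (ρ z′ ∸ ρ w) ⟩
      sign z w * sign w z′                          ∎
      where open ≡-Reasoning

    sign-diag : ∀ z → sign z z ≡ 1ℤ
    sign-diag z = cong sgn (ℕ.n∸n≡0 (ρ z))

    InCalI-ĥ : ∀ r {p} → InCalI B r p → InCalI B r (ĥ p)
    InCalI-ĥ r {p} p∈𝓘 z z′ z≤z′ = Deg≤-scaleS (sign z z′) (p z z′) (p∈𝓘 z z′ z≤z′)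

    ĥ-cong : ∀ {p q} → p ≈ᴵ q → ĥ p ≈ᴵ ĥ q
    ĥ-cong p≈q z z′ z≤z′ = scaleS-cong (sign z z′) (p≈q z z′ z≤z′)

    ĥ-diag : ∀ p z → ĥ p z z ≈ₛ p z z
    ĥ-diag p z k = trans (cong (_* p z z k) (sign-diag z)) (ℤ.*-identityˡ (p z z k))

    ĥ-involutive : ∀ p → ĥ (ĥ p) ≈ᴵ p
    ĥ-involutive p z z′ _ = ≈ₛ-trans (scaleS-scaleS (sign z z′) (sign z z′) (p z z′))
      (λ k → trans (cong (_* p z z′ k) (sgn*sgn (ρ z′ ∸ ρ z))) (ℤ.*-identityˡ (p z z′ k)))

    ĥ-· : ∀ p q → ĥ (p · q) ≈ᴵ ĥ p · ĥ q
    ĥ-· p q z z′ _ = ≈ₛ-trans (≈ₛ-sym (sumFinS-scaleS size (sign z z′) (summand p q z z′)))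
      (sumFinS-cong size (λ w → ≈ₛ-trans (ifS-scaleS (inInt B z w z′) (sign z z′) (p z w ⊛ q w z′))
        (ifS-cong (inInt B z w z′) (λ w∈ → let (z≤w , w≤z′) = inInt⇒≤ w∈ in ≈ₛ-sym (begin
          scaleS (sign z w) (p z w) ⊛ scaleS (sign w z′) (q w z′)
            ≈⟨ ⊛-scaleSˡ (sign z w) (p z w) (scaleS (sign w z′) (q w z′)) ⟩
          scaleS (sign z w) (p z w ⊛ scaleS (sign w z′) (q w z′))
            ≈⟨ scaleS-cong (sign z w) (⊛-scaleSʳ (sign w z′) (p z w) (q w z′)) ⟩
          scaleS (sign z w) (scaleS (sign w z′) (p z w ⊛ q w z′))
            ≈⟨ scaleS-scaleS (sign z w) (sign w z′) _ ⟩
          scaleS (sign z w * sign w z′) (p z w ⊛ q w z′)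
            ≈⟨ (λ k → cong (_* (p z w ⊛ q w z′) k) (sign-split z≤w w≤z′)) ⟨
          scaleS (sign z z′) (p z w ⊛ q w z′) ∎)))))
      where open ≈ₛ-Reasoning

    ĥ-vanishes : ∀ p {z z′} → p z z′ ≈ₛ zeroS → ĥ p z z′ ≈ₛ zeroS
    ĥ-vanishes p {z} {z′} p≈0 = ≈ₛ-trans (scaleS-cong (sign z z′) p≈0) (scaleS-zero (sign z z′))

    vanishing⇒rev≈ĥ : ∀ r p {z z′} → p z z′ ≈ₛ zeroS → rev B r p z z′ ≈ₛ ĥ p z z′
    vanishing⇒rev≈ĥ r p {z} {z′} p≈0 = ≈ₛ-trans (revS-cong (r z z′) p≈0)
      (≈ₛ-trans (revS-zero (r z z′)) (≈ₛ-sym (ĥ-vanishes p p≈0)))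

    rev-ĥ : ∀ r p → rev B r (ĥ p) ≈ᴵ ĥ (rev B r p)
    rev-ĥ r p z z′ _ = revS-scaleS (r z z′) (sign z z′) (p z z′)

    ĥ-oneI : ĥ (oneI B) ≈ᴵ oneI B
    ĥ-oneI z z′ _ with z Fin.≟ z′
    ... | yes refl = λ k → trans (cong (_* oneS k) (sign-diag z)) (ℤ.*-identityˡ (oneS k))
    ... | no _     = λ k → ℤ.*-zeroʳ (sign z z′)

    Δ-ĥ : ∀ r p z z′ → Δ B r (ĥ p) z z′ ≈ₛ scaleS (sign z z′) (Δ B r p z z′)
    Δ-ĥ r p z z′ k with z Fin.≟ z′ | k
    ... | yes _ | _     = sym (ℤ.*-zeroʳ (sign z z′))
    ... | no _  | zero  = refl
    ... | no _  | suc i with suc i ≤ᵇ ((r z z′ ∸ 1) / 2)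
    ...   | true  = factor (sign z z′) (p z z′ (suc i)) (p z z′ i)
      where
      factor : ∀ c u v → c * u - c * v ≡ c * (u - v)
      factor c u v = trans (cong (c * u +_) (ℤ.neg-distribʳ-* c v)) (sym (ℤ.*-distribˡ-+ c u (- v)))
    ...   | false = sym (ℤ.*-zeroʳ (sign z z′))

    module _ (eulerian : ∀ z z′ → _<_ B z z′ →
                         sumFin size (λ w → if inInt B z w z′ then sgn (ρ w) else 0ℤ) ≡ 0ℤ) where

      relative-signs : ∀ {z z′} → _<_ B z z′ → sumFin size (λ w → ifZ (inInt B z w z′) (sign z w)) ≡ 0ℤ
      relative-signs {z} {z′} z<z′ = begin
        sumFin size (λ w → ifZ (inInt B z w z′) (sign z w))
          ≡⟨ sumFin-cong size (λ w → trans (ifZ-cong (inInt B z w z′) (λ w∈ → sgn-∸ (ρ-mono (proj₁ (inInt⇒≤ w∈)))))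
                                           (ifZ-*ˡ (inInt B z w z′) (sgn (ρ z)) (sgn (ρ w)))) ⟩
        sumFin size (λ w → sgn (ρ z) * ifZ (inInt B z w z′) (sgn (ρ w)))
          ≡⟨ sumFin-*ˡ size (sgn (ρ z)) _ ⟩
        sgn (ρ z) * sumFin size (λ w → ifZ (inInt B z w z′) (sgn (ρ w)))
          ≡⟨ cong (sgn (ρ z) *_) (eulerian z z′ z<z′) ⟩
        sgn (ρ z) * 0ℤ
          ≡⟨ ℤ.*-zeroʳ (sgn (ρ z)) ⟩
        0ℤ ∎
        where open ≡-Reasoning

      multiplicative⇒ĥκ·κ≈1 : ∀ κ → Multiplicative B κ → (∀ z → κ z z ≈ₛ oneS) →
               ĥ κ · κ ≈ᴵ oneI B
      multiplicative⇒ĥκ·κ≈1 κ κ-mult κ-unit z z′ z≤z′ with z Fin.≟ z′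
      ... | yes refl = ≈ₛ-trans (mul-diag (ĥ κ) κ z)
                         (≈ₛ-trans (⊛-cong (≈ₛ-trans (ĥ-diag κ z) (κ-unit z)) (κ-unit z)) (⊛-identityˡ oneS))
      ... | no z≢z′ = begin
        (ĥ κ · κ) z z′
          ≈⟨ sumFinS-cong size (λ w → ifS-cong (inInt B z w z′) (λ w∈ → let (z≤w , w≤z′) = inInt⇒≤ w∈ in
               ≈ₛ-trans (⊛-scaleSˡ (sign z w) (κ z w) (κ w z′))
                        (scaleS-cong (sign z w) (≈ₛ-sym (κ-mult z w z′ z≤w w≤z′))))) ⟩
        sumFinS size (λ w → ifS (inInt B z w z′) (scaleS (sign z w) (κ z z′)))
          ≈⟨ sumFinS-ifS-scaleS size (λ w → inInt B z w z′) (sign z) (κ z z′) ⟩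
        scaleS (sumFin size (λ w → ifZ (inInt B z w z′) (sign z w))) (κ z z′)
          ≈⟨ (λ k → cong (_* κ z z′ k) (relative-signs (z≤z′ , z≢z′))) ⟩
        scaleS 0ℤ (κ z z′)
          ≈⟨ (λ k → ℤ.*-zeroˡ (κ z z′ k)) ⟩
        zeroS ∎
        where open ≈ₛ-Reasoning

-- Rank functions

count : ∀ n → (Fin n → Bool) → ℕ
count zero    P = 0
count (suc n) P = (if P Fin.zero then 1 else 0) ℕ.+ count n (λ w → P (Fin.suc w))

private
  indicator-mono : ∀ (b c : Bool) → (b ≡ true → c ≡ true) → (if b then 1 else 0) ℕ.≤ (if c then 1 else 0)
  indicator-mono true  true  _   = ℕ.≤-refl
  indicator-mono true  false b⇒c with b⇒c refl
  ... | ()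
  indicator-mono false c     _   = z≤n

count-mono : ∀ n (P Q : Fin n → Bool) → (∀ w → P w ≡ true → Q w ≡ true) → count n P ℕ.≤ count n Q
count-mono zero    P Q P⇒Q = z≤n
count-mono (suc n) P Q P⇒Q = ℕ.+-mono-≤ (indicator-mono (P Fin.zero) (Q Fin.zero) (P⇒Q Fin.zero))
                                        (count-mono n _ _ (λ w → P⇒Q (Fin.suc w)))

count-mono-< : ∀ n (P Q : Fin n → Bool) → (∀ w → P w ≡ true → Q w ≡ true) →
               ∀ a → P a ≡ false → Q a ≡ true → count n P ℕ.< count n Q
count-mono-< (suc n) P Q P⇒Q Fin.zero    Pa Qa rewrite Pa | Qa = s≤s (count-mono n _ _ (λ w → P⇒Q (Fin.suc w)))
count-mono-< (suc n) P Q P⇒Q (Fin.suc a) Pa Qa =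
  ℕ.+-mono-≤-< (indicator-mono (P Fin.zero) (Q Fin.zero) (P⇒Q Fin.zero))
               (count-mono-< n _ _ (λ w → P⇒Q (Fin.suc w)) a Pa Qa)

-- By induction on the size of the interval [z, z′]: either z′ covers z, or
-- some w splits it into two strictly smaller intervals.
rank-mono : ∀ (B : FinOrd) → IsPartialOrder _≡_ (FinOrd._≤_ B) → (ρ : Fin (FinOrd.size B) → ℕ) →
            (∀ z z′ → Covers B z z′ → ρ z′ ≡ suc (ρ z)) →
            ∀ {z z′} → FinOrd._≤_ B z z′ → ρ z ℕ.≤ ρ z′
rank-mono B B-po ρ covers {z} {z′} z≤z′ = go (size-of z z′) z z′ ℕ.≤-refl z≤z′
  where
  open FinOrd B using (size; _≤_; _≤?_)
  open IsPartialOrder B-po using () renaming (refl to ≤-refl; trans to ≤-trans; antisym to ≤-antisym)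
  open Intervals B

  size-of : Fin size → Fin size → ℕ
  size-of z z′ = count size (λ w → inInt B z w z′)

  _<?_ : ∀ a b → Dec (_<_ B a b)
  a <? b = (a ≤? b) ×-dec ¬? (a Fin.≟ b)

  go : ∀ n z z′ → size-of z z′ ℕ.≤ n → z ≤ z′ → ρ z ℕ.≤ ρ z′
  go n z z′ bound z≤z′ with z Fin.≟ z′
  ... | yes refl = ℕ.≤-refl
  ... | no z≢z′ with Fin.any? (λ w → (z <? w) ×-dec (w <? z′))
  ...   | no ∄w = subst (ρ z ℕ.≤_) (sym (covers z z′ ((z≤z′ , z≢z′) , λ w z<w w<z′ → ∄w (w , z<w , w<z′))))
                        (ℕ.n≤1+n (ρ z))
  ...   | yes (w , (z≤w , z≢w) , (w≤z′ , w≢z′)) = split n bound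
    where
    left-smaller : size-of z w ℕ.< size-of z z′
    left-smaller = count-mono-< size _ _
      (λ v v∈ → let (z≤v , v≤w) = inInt⇒≤ v∈ in inInt-true z≤v (≤-trans v≤w w≤z′)) z′
      (inInt-false (λ (_ , z′≤w) → w≢z′ (≤-antisym w≤z′ z′≤w))) (inInt-true z≤z′ ≤-refl)
    right-smaller : size-of w z′ ℕ.< size-of z z′
    right-smaller = count-mono-< size _ _
      (λ v v∈ → let (w≤v , v≤z′) = inInt⇒≤ v∈ in inInt-true (≤-trans z≤w w≤v) v≤z′) z
      (inInt-false (λ (w≤z , _) → z≢w (≤-antisym z≤w w≤z))) (inInt-true ≤-refl z≤z′)
    split : ∀ n → size-of z z′ ℕ.≤ n → ρ z ℕ.≤ ρ z′
    split zero    bound with ℕ.≤-trans left-smaller bound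
    ... | ()
    split (suc n) bound = ℕ.≤-trans (go n z w (ℕ.s≤s⁻¹ (ℕ.≤-trans left-smaller bound)) z≤w)
                                    (go n w z′ (ℕ.s≤s⁻¹ (ℕ.≤-trans right-smaller bound)) w≤z′)

-- The poset Γ of a strong formal subdivision

module SubdivisionPoset
  (X Y : FinOrd) (ρX : Fin (FinOrd.size X) → ℕ) (ρY : Fin (FinOrd.size Y) → ℕ)
  (X-eulerian : IsLowerEulerian X ρX) (Y-eulerian : IsLowerEulerian Y ρY)
  (σ : Fin (FinOrd.size X) → Fin (FinOrd.size Y))
  (σ-subdivision : IsStrongFormalSubdivision X Y ρX ρY σ)
  where

  module X = FinOrd X
  module Y = FinOrd Y

  nX nY : ℕ
  nX = X.size
  nY = Y.size

  Γ : FinOrd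
  Γ = Gam X Y σ

  N : ℕ
  N = nX ℕ.+ nY

  ρΓ : Fin N → ℕ
  ρΓ = ρGam X Y σ ρX ρY

  iX : Fin nX → Fin N
  iX = inX X Y σ

  iY : Fin nY → Fin N
  iY = inY X Y σ

  infix 4 _≤Γ_
  _≤Γ_ : Fin N → Fin N → Set
  _≤Γ_ = FinOrd._≤_ Γ

  module ≤X = IsPartialOrder (proj₁ X-eulerian)
  module ≤Y = IsPartialOrder (proj₁ Y-eulerian)

  σ-mono : ∀ {x x′} → x X.≤ x′ → σ x Y.≤ σ x′
  σ-mono = proj₁ σ-subdivision _ _

  ρX≤ρYσ : ∀ x → ρX x ℕ.≤ ρY (σ x)
  ρX≤ρYσ = proj₁ (proj₂ σ-subdivision)

  fibre-signs : ∀ x y → σ x Y.≤ y →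
    sumFin nX (λ x′ → if does (x X.≤? x′) ∧ does (σ x′ Fin.≟ y) then sgn (ρY y ∸ ρX x′) else 0ℤ) ≡ 1ℤ
  fibre-signs = proj₂ (proj₂ (proj₂ (proj₂ σ-subdivision)))

  X-signs : ∀ x x′ → _<_ X x x′ → sumFin nX (λ w → if inInt X x w x′ then sgn (ρX w) else 0ℤ) ≡ 0ℤ
  X-signs = proj₂ (proj₂ (proj₂ X-eulerian))

  Y-signs : ∀ y y′ → _<_ Y y y′ → sumFin nY (λ w → if inInt Y y w y′ then sgn (ρY w) else 0ℤ) ≡ 0ℤ
  Y-signs = proj₂ (proj₂ (proj₂ Y-eulerian))

  ρX-mono : ∀ {x x′} → x X.≤ x′ → ρX x ℕ.≤ ρX x′
  ρX-mono = rank-mono X (proj₁ X-eulerian) ρX (proj₁ (proj₂ (proj₂ X-eulerian)))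

  ρY-mono : ∀ {y y′} → y Y.≤ y′ → ρY y ℕ.≤ ρY y′
  ρY-mono = rank-mono Y (proj₁ Y-eulerian) ρY (proj₁ (proj₂ (proj₂ Y-eulerian)))

  splitAt-iX : ∀ x → splitAt nX (iX x) ≡ inj₁ x
  splitAt-iX x = Fin.splitAt-↑ˡ nX x nY

  splitAt-iY : ∀ y → splitAt nX (iY y) ≡ inj₂ y
  splitAt-iY y = Fin.splitAt-↑ʳ nX nY y

  data Side (a : Fin N) : Set where
    inX-side : ∀ x → a ≡ iX x → Side a
    inY-side : ∀ y → a ≡ iY y → Side a

  side : ∀ a → Side a
  side a with splitAt nX a in e
  ... | inj₁ x = inX-side x (trans (sym (Fin.join-splitAt nX nY a)) (cong (join nX nY) e))
  ... | inj₂ y = inY-side y (trans (sym (Fin.join-splitAt nX nY a)) (cong (join nX nY) e))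

  iX≢iY : ∀ x y → iX x ≢ iY y
  iX≢iY x y e with trans (sym (splitAt-iX x)) (trans (cong (splitAt nX) e) (splitAt-iY y))
  ... | ()

  iX≤iX⇒ : ∀ {x x′} → iX x ≤Γ iX x′ → x X.≤ x′
  iX≤iX⇒ {x} {x′} = subst₂ (GLe X Y σ) (splitAt-iX x) (splitAt-iX x′)
  iX≤iX⇐ : ∀ {x x′} → x X.≤ x′ → iX x ≤Γ iX x′
  iX≤iX⇐ {x} {x′} = subst₂ (GLe X Y σ) (sym (splitAt-iX x)) (sym (splitAt-iX x′))
  iX≤iY⇒ : ∀ {x y} → iX x ≤Γ iY y → σ x Y.≤ y
  iX≤iY⇒ {x} {y} = subst₂ (GLe X Y σ) (splitAt-iX x) (splitAt-iY y)
  iX≤iY⇐ : ∀ {x y} → σ x Y.≤ y → iX x ≤Γ iY y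
  iX≤iY⇐ {x} {y} = subst₂ (GLe X Y σ) (sym (splitAt-iX x)) (sym (splitAt-iY y))
  iY≤iY⇒ : ∀ {y y′} → iY y ≤Γ iY y′ → y Y.≤ y′
  iY≤iY⇒ {y} {y′} = subst₂ (GLe X Y σ) (splitAt-iY y) (splitAt-iY y′)
  iY≤iY⇐ : ∀ {y y′} → y Y.≤ y′ → iY y ≤Γ iY y′
  iY≤iY⇐ {y} {y′} = subst₂ (GLe X Y σ) (sym (splitAt-iY y)) (sym (splitAt-iY y′))
  iY≰iX : ∀ {y x} → ¬ iY y ≤Γ iX x
  iY≰iX {y} {x} = subst₂ (GLe X Y σ) (splitAt-iY y) (splitAt-iX x)

  above-iY : ∀ {y a} → iY y ≤Γ a → Σ (Fin nY) λ y′ → a ≡ iY y′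
  above-iY {y} {a} y≤a with side a
  ... | inX-side x  refl = ⊥-elim (iY≰iX y≤a)
  ... | inY-side y′ refl = y′ , refl

  below-iX : ∀ {a x} → a ≤Γ iX x → Σ (Fin nX) λ x′ → a ≡ iX x′
  below-iX {a} a≤x with side a
  ... | inX-side x′ refl = x′ , refl
  ... | inY-side y  refl = ⊥-elim (iY≰iX a≤x)

  Γ-isPartialOrder : IsPartialOrder _≡_ _≤Γ_
  Γ-isPartialOrder = record
    { isPreorder = record
      { isEquivalence = isEquivalence
      ; reflexive = λ { refl → ≤Γ-refl }
      ; trans = ≤Γ-trans }
    ; antisym = ≤Γ-antisym }
    where
    ≤Γ-refl : ∀ {a} → a ≤Γ a
    ≤Γ-refl {a} with side a
    ... | inX-side x refl = iX≤iX⇐ ≤X.refl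
    ... | inY-side y refl = iY≤iY⇐ ≤Y.refl
    ≤Γ-trans : ∀ {a b c} → a ≤Γ b → b ≤Γ c → a ≤Γ c
    ≤Γ-trans {a} {b} {c} a≤b b≤c with side a | side b | side c
    ... | inX-side _ refl | inX-side _ refl | inX-side _ refl = iX≤iX⇐ (≤X.trans (iX≤iX⇒ a≤b) (iX≤iX⇒ b≤c))
    ... | inX-side _ refl | inX-side _ refl | inY-side _ refl = iX≤iY⇐ (≤Y.trans (σ-mono (iX≤iX⇒ a≤b)) (iX≤iY⇒ b≤c))
    ... | inX-side _ refl | inY-side _ refl | inX-side _ refl = ⊥-elim (iY≰iX b≤c)
    ... | inX-side _ refl | inY-side _ refl | inY-side _ refl = iX≤iY⇐ (≤Y.trans (iX≤iY⇒ a≤b) (iY≤iY⇒ b≤c))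
    ... | inY-side _ refl | inX-side _ refl | _               = ⊥-elim (iY≰iX a≤b)
    ... | inY-side _ refl | inY-side _ refl | inX-side _ refl = ⊥-elim (iY≰iX b≤c)
    ... | inY-side _ refl | inY-side _ refl | inY-side _ refl = iY≤iY⇐ (≤Y.trans (iY≤iY⇒ a≤b) (iY≤iY⇒ b≤c))
    ≤Γ-antisym : ∀ {a b} → a ≤Γ b → b ≤Γ a → a ≡ b
    ≤Γ-antisym {a} {b} a≤b b≤a with side a | side b
    ... | inX-side _ refl | inX-side _ refl = cong iX (≤X.antisym (iX≤iX⇒ a≤b) (iX≤iX⇒ b≤a))
    ... | inX-side _ refl | inY-side _ refl = ⊥-elim (iY≰iX b≤a)
    ... | inY-side _ refl | inX-side _ refl = ⊥-elim (iY≰iX a≤b)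
    ... | inY-side _ refl | inY-side _ refl = cong iY (≤Y.antisym (iY≤iY⇒ a≤b) (iY≤iY⇒ b≤a))

  module ≤Γ = IsPartialOrder Γ-isPartialOrder

  ρΓ-iX : ∀ x → ρΓ (iX x) ≡ ρX x
  ρΓ-iX x rewrite splitAt-iX x = refl

  ρΓ-iY : ∀ y → ρΓ (iY y) ≡ suc (ρY y)
  ρΓ-iY y rewrite splitAt-iY y = refl

  ρΓ-mono : ∀ {a b} → a ≤Γ b → ρΓ a ℕ.≤ ρΓ b
  ρΓ-mono {a} {b} a≤b with side a | side b
  ... | inX-side x refl | inX-side x′ refl =
    subst₂ ℕ._≤_ (sym (ρΓ-iX x)) (sym (ρΓ-iX x′)) (ρX-mono (iX≤iX⇒ a≤b))
  ... | inX-side x refl | inY-side y refl =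
    subst₂ ℕ._≤_ (sym (ρΓ-iX x)) (sym (ρΓ-iY y)) (ℕ.m≤n⇒m≤1+n (ℕ.≤-trans (ρX≤ρYσ x) (ρY-mono (iX≤iY⇒ a≤b))))
  ... | inY-side y refl | inX-side x refl = ⊥-elim (iY≰iX a≤b)
  ... | inY-side y refl | inY-side y′ refl =
    subst₂ ℕ._≤_ (sym (ρΓ-iY y)) (sym (ρΓ-iY y′)) (s≤s (ρY-mono (iY≤iY⇒ a≤b)))

  inInt-XXX : ∀ x w x′ → inInt Γ (iX x) (iX w) (iX x′) ≡ inInt X x w x′
  inInt-XXX x w x′ rewrite splitAt-iX x | splitAt-iX w | splitAt-iX x′ = refl

  inInt-XXY : ∀ x w y → inInt Γ (iX x) (iX w) (iY y) ≡ does (x X.≤? w) ∧ does (σ w Y.≤? y)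
  inInt-XXY x w y rewrite splitAt-iX x | splitAt-iX w | splitAt-iY y = refl

  inInt-XYY : ∀ x w y → inInt Γ (iX x) (iY w) (iY y) ≡ inInt Y (σ x) w y
  inInt-XYY x w y rewrite splitAt-iX x | splitAt-iY w | splitAt-iY y = refl

  inInt-YYY : ∀ y w y′ → inInt Γ (iY y) (iY w) (iY y′) ≡ inInt Y y w y′
  inInt-YYY y w y′ rewrite splitAt-iY y | splitAt-iY w | splitAt-iY y′ = refl

  inInt-XYX : ∀ x w x′ → inInt Γ (iX x) (iY w) (iX x′) ≡ false
  inInt-XYX x w x′ rewrite splitAt-iX x | splitAt-iY w | splitAt-iX x′ = ∧-false _
    where
    ∧-false : ∀ b → b ∧ false ≡ false
    ∧-false true  = refl
    ∧-false false = refl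

  inInt-YX- : ∀ y w b → inInt Γ (iY y) (iX w) b ≡ false
  inInt-YX- y w b rewrite splitAt-iY y | splitAt-iX w = refl

  sumFinS-Γ : ∀ (F : Fin N → Series) → sumFinS N F ≈ₛ (sumFinS nX (λ x → F (iX x)) ⊕ sumFinS nY (λ y → F (iY y)))
  sumFinS-Γ F k = sumFin-↑ nX nY (λ w → F w k)

  -- Rewriting (-1)^{ρX x′} as (-1)^{ρY y} (-1)^{ρY y - ρX x′} turns the sum into
  -- (-1)^{ρY y} times the defining sum of a strong formal subdivision.
  fibre-signs′ : ∀ x y → σ x Y.≤ y →
    sumFin nX (λ x′ → ifZ (does (x X.≤? x′) ∧ does (σ x′ Fin.≟ y)) (sgn (ρX x′))) ≡ sgn (ρY y)
  fibre-signs′ x y σx≤y = begin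
    sumFin nX (λ x′ → ifZ (A x′) (sgn (ρX x′)))
      ≡⟨ sumFin-cong nX term ⟩
    sumFin nX (λ x′ → sgn (ρY y) * ifZ (A x′) (sgn (ρY y ∸ ρX x′)))
      ≡⟨ sumFin-*ˡ nX (sgn (ρY y)) _ ⟩
    sgn (ρY y) * sumFin nX (λ x′ → ifZ (A x′) (sgn (ρY y ∸ ρX x′)))
      ≡⟨ cong (sgn (ρY y) *_) (fibre-signs x y σx≤y) ⟩
    sgn (ρY y) * 1ℤ
      ≡⟨ ℤ.*-identityʳ _ ⟩
    sgn (ρY y) ∎
    where
    open ≡-Reasoning
    A : Fin nX → Bool
    A x′ = does (x X.≤? x′) ∧ does (σ x′ Fin.≟ y)
    term : ∀ x′ → ifZ (A x′) (sgn (ρX x′)) ≡ sgn (ρY y) * ifZ (A x′) (sgn (ρY y ∸ ρX x′))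
    term x′ with x X.≤? x′ | σ x′ Fin.≟ y
    ... | no _  | _      = sym (ℤ.*-zeroʳ (sgn (ρY y)))
    ... | yes _ | no _   = sym (ℤ.*-zeroʳ (sgn (ρY y)))
    ... | yes _ | yes refl = sym (begin
      s * sgn (ρY (σ x′) ∸ ρX x′)   ≡⟨ cong (s *_) (sgn-∸ (ρX≤ρYσ x′)) ⟩
      s * (sgn (ρX x′) * s)         ≡⟨ cong (s *_) (ℤ.*-comm (sgn (ρX x′)) s) ⟩
      s * (s * sgn (ρX x′))         ≡⟨ ℤ.*-assoc s s _ ⟨
      (s * s) * sgn (ρX x′)         ≡⟨ cong (_* sgn (ρX x′)) (sgn*sgn (ρY (σ x′))) ⟩
      1ℤ * sgn (ρX x′)              ≡⟨ ℤ.*-identityˡ _ ⟩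
      sgn (ρX x′)                   ∎)
      where
      s : ℤ
      s = sgn (ρY (σ x′))

  -- Grouping the elements x′ ≥ x of X with σ x′ ≤ y by the fibres of σ.
  signs-below-iY : ∀ x y →
    sumFin nX (λ x′ → ifZ (does (x X.≤? x′) ∧ does (σ x′ Y.≤? y)) (sgn (ρX x′)))
    ≡ sumFin nY (λ y′ → ifZ (inInt Y (σ x) y′ y) (sgn (ρY y′)))
  signs-below-iY x y = begin
    sumFin nX (λ x′ → ifZ (does (x X.≤? x′) ∧ does (σ x′ Y.≤? y)) (sgn (ρX x′)))
      ≡⟨ sumFin-cong nX (λ x′ → sym (only-σx′ x′)) ⟩
    sumFin nX (λ x′ → sumFin nY (λ y′ → ifZ (inInt Y (σ x) y′ y) (ifZ (E x′ y′) (sgn (ρX x′)))))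
      ≡⟨ sumFin-comm nX nY _ ⟩
    sumFin nY (λ y′ → sumFin nX (λ x′ → ifZ (inInt Y (σ x) y′ y) (ifZ (E x′ y′) (sgn (ρX x′)))))
      ≡⟨ sumFin-cong nY (λ y′ → sym (ifZ-sumFin (inInt Y (σ x) y′ y) nX _)) ⟩
    sumFin nY (λ y′ → ifZ (inInt Y (σ x) y′ y) (sumFin nX (λ x′ → ifZ (E x′ y′) (sgn (ρX x′)))))
      ≡⟨ sumFin-cong nY (λ y′ → ifZ-cong (inInt Y (σ x) y′ y) (λ y′∈ → fibre-signs′ x y′ (proj₁ (inInt⇒≤ y′∈)))) ⟩
    sumFin nY (λ y′ → ifZ (inInt Y (σ x) y′ y) (sgn (ρY y′))) ∎
    where
    open ≡-Reasoning
    open Intervals Y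
    E : Fin nX → Fin nY → Bool
    E x′ y′ = does (x X.≤? x′) ∧ does (σ x′ Fin.≟ y′)
    ifZ-sumFin : ∀ b n (F : Fin n → ℤ) → ifZ b (sumFin n F) ≡ sumFin n (λ w → ifZ b (F w))
    ifZ-sumFin true  n F = refl
    ifZ-sumFin false n F = sym (sumFin-zero n (λ w → refl))
    ifZ-0 : ∀ b → ifZ b 0ℤ ≡ 0ℤ
    ifZ-0 true  = refl
    ifZ-0 false = refl
    only-σx′ : ∀ x′ → sumFin nY (λ y′ → ifZ (inInt Y (σ x) y′ y) (ifZ (E x′ y′) (sgn (ρX x′))))
                      ≡ ifZ (does (x X.≤? x′) ∧ does (σ x′ Y.≤? y)) (sgn (ρX x′))
    only-σx′ x′ = trans (sumFin-select nY _ (σ x′) off-σx′) at-σx′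
      where
      off-σx′ : ∀ y′ → y′ ≢ σ x′ → ifZ (inInt Y (σ x) y′ y) (ifZ (E x′ y′) (sgn (ρX x′))) ≡ 0ℤ
      off-σx′ y′ y′≢σx′ with x X.≤? x′ | σ x′ Fin.≟ y′
      ... | _     | yes σx′≡y′ = ⊥-elim (y′≢σx′ (sym σx′≡y′))
      ... | yes _ | no _ = ifZ-0 (inInt Y (σ x) y′ y)
      ... | no _  | no _ = ifZ-0 (inInt Y (σ x) y′ y)
      at-σx′ : ifZ (inInt Y (σ x) (σ x′) y) (ifZ (E x′ (σ x′)) (sgn (ρX x′)))
               ≡ ifZ (does (x X.≤? x′) ∧ does (σ x′ Y.≤? y)) (sgn (ρX x′))
      at-σx′ with x X.≤? x′ | σ x′ Fin.≟ σ x′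
      ... | _       | no σx′≢σx′ = ⊥-elim (σx′≢σx′ refl)
      ... | no _    | yes _ = ifZ-0 (inInt Y (σ x) (σ x′) y)
      ... | yes x≤x′ | yes _ with σ x Y.≤? σ x′
      ...   | yes _     = refl
      ...   | no σx≰σx′ = ⊥-elim (σx≰σx′ (σ-mono x≤x′))

  Γ-signs-split : ∀ a b → sumFin N (λ w → ifZ (inInt Γ a w b) (sgn (ρΓ w)))
    ≡ sumFin nX (λ x → ifZ (inInt Γ a (iX x) b) (sgn (ρX x)))
      - sumFin nY (λ y → ifZ (inInt Γ a (iY y) b) (sgn (ρY y)))
  Γ-signs-split a b = trans (sumFin-↑ nX nY _) (cong₂ _+_
    (sumFin-cong nX (λ x → cong (ifZ (inInt Γ a (iX x) b)) (cong sgn (ρΓ-iX x))))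
    (trans (sumFin-cong nY (λ y → trans (cong (ifZ (inInt Γ a (iY y) b))
                                              (trans (cong sgn (ρΓ-iY y)) (sgn-suc (ρY y))))
                                        (ifZ-neg (inInt Γ a (iY y) b) (sgn (ρY y)))))
           (sumFin-neg nY _)))

  Γ-signs : ∀ a b → _<_ Γ a b → sumFin N (λ w → if inInt Γ a w b then sgn (ρΓ w) else 0ℤ) ≡ 0ℤ
  Γ-signs a b (a≤b , a≢b) with side a | side b
  ... | inY-side y refl | inX-side x refl = ⊥-elim (iY≰iX a≤b)
  ... | inX-side x refl | inX-side x′ refl = begin
    sumFin N (λ w → ifZ (inInt Γ a w b) (sgn (ρΓ w)))                   ≡⟨ Γ-signs-split a b ⟩
    sumFin nX (λ w → ifZ (inInt Γ a (iX w) b) (sgn (ρX w)))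
      - sumFin nY (λ w → ifZ (inInt Γ a (iY w) b) (sgn (ρY w)))
        ≡⟨ cong₂ _-_ (trans (sumFin-cong nX (λ w → cong (λ c → ifZ c (sgn (ρX w))) (inInt-XXX x w x′)))
                            (X-signs x x′ (iX≤iX⇒ a≤b , a≢b ∘ cong iX)))
                     (sumFin-zero nY (λ w → cong (λ c → ifZ c (sgn (ρY w))) (inInt-XYX x w x′))) ⟩
    0ℤ - 0ℤ                                                              ≡⟨⟩
    0ℤ                                                                   ∎
    where open ≡-Reasoning
  ... | inX-side x refl | inY-side y refl = begin
    sumFin N (λ w → ifZ (inInt Γ a w b) (sgn (ρΓ w)))                   ≡⟨ Γ-signs-split a b ⟩
    sumFin nX (λ w → ifZ (inInt Γ a (iX w) b) (sgn (ρX w)))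
      - sumFin nY (λ w → ifZ (inInt Γ a (iY w) b) (sgn (ρY w)))
        ≡⟨ cong₂ _-_ (trans (sumFin-cong nX (λ w → cong (λ c → ifZ c (sgn (ρX w))) (inInt-XXY x w y)))
                            (signs-below-iY x y))
                     (sumFin-cong nY (λ w → cong (λ c → ifZ c (sgn (ρY w))) (inInt-XYY x w y))) ⟩
    S - S                                                                ≡⟨ ℤ.+-inverseʳ S ⟩
    0ℤ                                                                   ∎
    where
    open ≡-Reasoning
    S : ℤ
    S = sumFin nY (λ y′ → ifZ (inInt Y (σ x) y′ y) (sgn (ρY y′)))
  ... | inY-side y refl | inY-side y′ refl = begin
    sumFin N (λ w → ifZ (inInt Γ a w b) (sgn (ρΓ w)))                   ≡⟨ Γ-signs-split a b ⟩
    sumFin nX (λ w → ifZ (inInt Γ a (iX w) b) (sgn (ρX w)))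
      - sumFin nY (λ w → ifZ (inInt Γ a (iY w) b) (sgn (ρY w)))
        ≡⟨ cong₂ _-_ (sumFin-zero nX (λ w → cong (λ c → ifZ c (sgn (ρX w))) (inInt-YX- y w b)))
                     (trans (sumFin-cong nY (λ w → cong (λ c → ifZ c (sgn (ρY w))) (inInt-YYY y w y′)))
                            (Y-signs y y′ (iY≤iY⇒ a≤b , a≢b ∘ cong iY))) ⟩
    0ℤ - 0ℤ                                                              ≡⟨⟩
    0ℤ                                                                   ∎
    where open ≡-Reasoning

  resXYo-XY : ∀ p x y → resXYo X Y σ p (iX x) (iY y) ≈ₛ ifS (does (σ x Fin.≟ y)) (p (iX x) (iY y))
  resXYo-XY p x y rewrite splitAt-iX x | splitAt-iY y = ≈ₛ-refl

  resXYo-XX : ∀ p x x′ → resXYo X Y σ p (iX x) (iX x′) ≈ₛ zeroS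
  resXYo-XX p x x′ rewrite splitAt-iX x | splitAt-iX x′ = ≈ₛ-refl

  resXYo-Y- : ∀ p y b → resXYo X Y σ p (iY y) b ≈ₛ zeroS
  resXYo-Y- p y b rewrite splitAt-iY y = ≈ₛ-refl

  resXYo--X : ∀ p a x → resXYo X Y σ p a (iX x) ≈ₛ zeroS
  resXYo--X p a x with side a
  ... | inX-side x′ refl = resXYo-XX p x′ x
  ... | inY-side y  refl = resXYo-Y- p y (iX x)

  resXY-XY : ∀ p x y → resXY X Y σ p (iX x) (iY y) ≈ₛ p (iX x) (iY y)
  resXY-XY p x y rewrite splitAt-iX x | splitAt-iY y = ≈ₛ-refl

  resXY-XX : ∀ p x x′ → resXY X Y σ p (iX x) (iX x′) ≈ₛ zeroS
  resXY-XX p x x′ rewrite splitAt-iX x | splitAt-iX x′ = ≈ₛ-refl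

  resXY-Y- : ∀ p y b → resXY X Y σ p (iY y) b ≈ₛ zeroS
  resXY-Y- p y b rewrite splitAt-iY y = ≈ₛ-refl

  resX-XX : ∀ p x x′ → resX X Y σ p (iX x) (iX x′) ≈ₛ p (iX x) (iX x′)
  resX-XX p x x′ rewrite splitAt-iX x | splitAt-iX x′ = ≈ₛ-refl

  resXYo-fibre : ∀ p x → resXYo X Y σ p (iX x) (iY (σ x)) ≈ₛ p (iX x) (iY (σ x))
  resXYo-fibre p x = ≈ₛ-trans (resXYo-XY p x (σ x)) (ifS-true _ (dec-true (σ x Fin.≟ σ x) refl))

  resXYo-off-fibre : ∀ p {x y} → σ x ≢ y → resXYo X Y σ p (iX x) (iY y) ≈ₛ zeroS
  resXYo-off-fibre p {x} {y} σx≢y =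
    ≈ₛ-trans (resXYo-XY p x y) (λ k → cong (λ b → ifS b (p (iX x) (iY y)) k) (dec-false (σ x Fin.≟ y) σx≢y))

  Y-signs-from-top : ∀ y₀ y → y₀ Y.≤ y →
    sumFin nY (λ y′ → ifZ (inInt Y y₀ y′ y) (sgn (ρY y ∸ ρY y′))) ≡ ifZ (does (y₀ Fin.≟ y)) 1ℤ
  Y-signs-from-top y₀ y y₀≤y with y₀ Fin.≟ y
  ... | yes refl = trans (sumFin-select nY _ y₀ off-y₀)
                     (trans (cong (λ b → ifZ b (sgn (ρY y₀ ∸ ρY y₀))) (inInt-true ≤Y.refl ≤Y.refl))
                            (cong sgn (ℕ.n∸n≡0 (ρY y₀))))
    where
    open Intervals Y
    off-y₀ : ∀ y′ → y′ ≢ y₀ → ifZ (inInt Y y₀ y′ y₀) (sgn (ρY y₀ ∸ ρY y′)) ≡ 0ℤ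
    off-y₀ y′ y′≢y₀ with inInt Y y₀ y′ y₀ in e
    ... | true  = ⊥-elim (y′≢y₀ (≤Y.antisym (proj₂ (inInt⇒≤ e)) (proj₁ (inInt⇒≤ e))))
    ... | false = refl
  ... | no y₀≢y = begin
    sumFin nY (λ y′ → ifZ (inInt Y y₀ y′ y) (sgn (ρY y ∸ ρY y′)))
      ≡⟨ sumFin-cong nY (λ y′ → trans (ifZ-cong (inInt Y y₀ y′ y) (λ y′∈ →
           trans (sgn-∸ (ρY-mono (proj₂ (inInt⇒≤ y′∈)))) (ℤ.*-comm (sgn (ρY y′)) (sgn (ρY y)))))
                                      (ifZ-*ˡ (inInt Y y₀ y′ y) (sgn (ρY y)) (sgn (ρY y′)))) ⟩
    sumFin nY (λ y′ → sgn (ρY y) * ifZ (inInt Y y₀ y′ y) (sgn (ρY y′)))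
      ≡⟨ sumFin-*ˡ nY (sgn (ρY y)) _ ⟩
    sgn (ρY y) * sumFin nY (λ y′ → ifZ (inInt Y y₀ y′ y) (sgn (ρY y′)))
      ≡⟨ cong (sgn (ρY y) *_) (Y-signs y₀ y (y₀≤y , y₀≢y)) ⟩
    sgn (ρY y) * 0ℤ
      ≡⟨ ℤ.*-zeroʳ (sgn (ρY y)) ⟩
    0ℤ ∎
    where
    open ≡-Reasoning
    open Intervals Y

module Kernel
  (X Y : FinOrd) (ρX : Fin (FinOrd.size X) → ℕ) (ρY : Fin (FinOrd.size Y) → ℕ)
  (X-eulerian : IsLowerEulerian X ρX) (Y-eulerian : IsLowerEulerian Y ρY)
  (σ : Fin (FinOrd.size X) → Fin (FinOrd.size Y))
  (σ-subdivision : IsStrongFormalSubdivision X Y ρX ρY σ)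
  (r : Elt (Gam X Y σ) → Elt (Gam X Y σ) → ℕ) (r-weak : IsWeakRank (Gam X Y σ) r)
  (κ : Inc (Gam X Y σ)) (κ∈𝓘 : InCalI (Gam X Y σ) r κ) (κ-unit : InU (Gam X Y σ) r κ)
  (κ-mult : Multiplicative (Gam X Y σ) κ)
  (κ-alt : RankAlternating (Gam X Y σ) r (ρGam X Y σ ρX ρY) κ)
  where

  open SubdivisionPoset X Y ρX ρY X-eulerian Y-eulerian σ σ-subdivision public
  open IncidenceAlgebra Γ Γ-isPartialOrder public
  open Ranked r r-weak public
  open Signed ρΓ ρΓ-mono public
  open Intervals Γ public

  κ° : Inc Γ
  κ° = resXYo X Y σ κ

  κ|XY : Inc Γ
  κ|XY = resXY X Y σ κ

  ĥκ·κ≈1 : ĥ κ · κ ≈ᴵ oneI Γ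
  ĥκ·κ≈1 = multiplicative⇒ĥκ·κ≈1 Γ-signs κ κ-mult κ-unit

  κ°-diag : ∀ a → κ° a a ≈ₛ zeroS
  κ°-diag a with side a
  ... | inX-side x refl = resXYo-XX κ x x
  ... | inY-side y refl = resXYo-Y- κ y (iY y)

  κ°∈𝓘 : InCalI Γ r κ°
  κ°∈𝓘 a b a≤b with side a | side b
  ... | inX-side x refl | inX-side x′ refl = Deg≤-cong (≈ₛ-sym (resXYo-XX κ x x′)) (λ _ _ → refl)
  ... | inX-side x refl | inY-side y refl =
    Deg≤-cong (≈ₛ-sym (resXYo-XY κ x y))
              (Deg≤-ifS (r (iX x) (iY y)) (does (σ x Fin.≟ y)) _ (λ _ → κ∈𝓘 (iX x) (iY y) a≤b))
  ... | inY-side y refl | _ = Deg≤-cong (≈ₛ-sym (resXYo-Y- κ y b)) (λ _ _ → refl)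

  rev-κ° : rev Γ r κ° ≈ᴵ ĥ κ°
  rev-κ° a b a≤b with side a | side b
  ... | inX-side x refl | inX-side x′ refl = vanishing⇒rev≈ĥ r κ° (resXYo-XX κ x x′)
  ... | inY-side y refl | _ = vanishing⇒rev≈ĥ r κ° (resXYo-Y- κ y b)
  ... | inX-side x refl | inY-side y refl = begin
    revS (r a b) (κ° a b)                                   ≈⟨ revS-cong (r a b) (resXYo-XY κ x y) ⟩
    revS (r a b) (ifS (does (σ x Fin.≟ y)) (κ a b))          ≈⟨ revS-ifS (r a b) (does (σ x Fin.≟ y)) (κ a b) ⟩
    ifS (does (σ x Fin.≟ y)) (revS (r a b) (κ a b))          ≈⟨ ifS-cong (does (σ x Fin.≟ y)) (λ _ → κ-alt a b a≤b) ⟩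
    ifS (does (σ x Fin.≟ y)) (scaleS (sign a b) (κ a b))     ≈⟨ ifS-scaleS (does (σ x Fin.≟ y)) (sign a b) (κ a b) ⟨
    scaleS (sign a b) (ifS (does (σ x Fin.≟ y)) (κ a b))     ≈⟨ scaleS-cong (sign a b) (resXYo-XY κ x y) ⟨
    ĥ κ° a b ∎
    where open ≈ₛ-Reasoning

  sign-iX-iY : ∀ {x′ y} → ρX x′ ℕ.≤ ρY y → sign (iX x′) (iY y) ≡ - sgn (ρY y ∸ ρX x′)
  sign-iX-iY {x′} {y} ρx′≤ρy = trans (cong₂ (λ u v → sgn (u ∸ v)) (ρΓ-iY y) (ρΓ-iX x′))
    (trans (cong sgn (ℕ.+-∸-assoc 1 ρx′≤ρy)) (sgn-suc (ρY y ∸ ρX x′)))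

  sign-iY-iY : ∀ y′ y → sign (iY y′) (iY y) ≡ sgn (ρY y ∸ ρY y′)
  sign-iY-iY y′ y = cong₂ (λ u v → sgn (u ∸ v)) (ρΓ-iY y) (ρΓ-iY y′)

  fibre : Fin nX → Fin nY → Fin nX → Bool
  fibre x y x′ = does (x X.≤? x′) ∧ does (σ x′ Fin.≟ y)

  fibre-sign-sum : ∀ x y → σ x Y.≤ y → sumFin nX (λ x′ → ifZ (fibre x y x′) (sign (iX x′) (iY y))) ≡ -1ℤ
  fibre-sign-sum x y σx≤y = begin
    sumFin nX (λ x′ → ifZ (fibre x y x′) (sign (iX x′) (iY y)))
      ≡⟨ sumFin-cong nX (λ x′ → trans (ifZ-cong (fibre x y x′) (λ e → sign-iX-iY (ρx′≤ρy x′ e)))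
                                      (ifZ-neg (fibre x y x′) _)) ⟩
    sumFin nX (λ x′ → - ifZ (fibre x y x′) (sgn (ρY y ∸ ρX x′)))
      ≡⟨ sumFin-neg nX _ ⟩
    - sumFin nX (λ x′ → ifZ (fibre x y x′) (sgn (ρY y ∸ ρX x′)))
      ≡⟨ cong -_ (fibre-signs x y σx≤y) ⟩
    -1ℤ ∎
    where
    open ≡-Reasoning
    ρx′≤ρy : ∀ x′ → fibre x y x′ ≡ true → ρX x′ ℕ.≤ ρY y
    ρx′≤ρy x′ e with x X.≤? x′ | σ x′ Fin.≟ y
    ρx′≤ρy x′ e  | yes _ | yes refl = ρX≤ρYσ x′
    ρx′≤ρy x′ () | yes _ | no _
    ρx′≤ρy x′ () | no _  | _

  κ·ĥκ°-summand-X : ∀ x y x′ → summand κ (ĥ κ°) (iX x) (iY y) (iX x′)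
                                ≈ₛ ifS (fibre x y x′) (scaleS (sign (iX x′) (iY y)) (κ (iX x) (iY y)))
  κ·ĥκ°-summand-X x y x′ rewrite inInt-XXY x x′ y with x X.≤? x′
  ... | no _ = ≈ₛ-refl
  ... | yes x≤x′ with σ x′ Fin.≟ y
  ...   | no σx′≢y = ifS-zero (does (σ x′ Y.≤? y)) (λ _ →
            ⊛-vanishesʳ (κ (iX x) (iX x′)) (ĥ-vanishes κ° (resXYo-off-fibre κ σx′≢y)))
  ...   | yes refl rewrite dec-true (σ x′ Y.≤? σ x′) ≤Y.refl = begin
    κ a (iX x′) ⊛ scaleS s (κ° (iX x′) b)    ≈⟨ ⊛-scaleSʳ s (κ a (iX x′)) (κ° (iX x′) b) ⟩
    scaleS s (κ a (iX x′) ⊛ κ° (iX x′) b)    ≈⟨ scaleS-cong s (⊛-congˡ (κ a (iX x′)) (resXYo-fibre κ x′)) ⟩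
    scaleS s (κ a (iX x′) ⊛ κ (iX x′) b)     ≈⟨ scaleS-cong s (κ-mult a (iX x′) b (iX≤iX⇐ x≤x′) (iX≤iY⇐ ≤Y.refl)) ⟨
    scaleS s (κ a b)                         ∎
    where
    open ≈ₛ-Reasoning
    a b : Fin N
    a = iX x
    b = iY (σ x′)
    s : ℤ
    s = sign (iX x′) b

  -- Only x′ in the fibre of y contributes, with κ x x′ κ x′ y = κ x y, and the
  -- signs add up to -1 by the defining property of a strong formal subdivision.
  κ·ĥκ°-XY : ∀ {x y} → σ x Y.≤ y → (κ · ĥ κ°) (iX x) (iY y) ≈ₛ negS (κ (iX x) (iY y))
  κ·ĥκ°-XY {x} {y} σx≤y = begin
    (κ · ĥ κ°) a b
      ≈⟨ sumFinS-Γ (summand κ (ĥ κ°) a b) ⟩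
    sumFinS nX (λ x′ → summand κ (ĥ κ°) a b (iX x′)) ⊕ sumFinS nY (λ y′ → summand κ (ĥ κ°) a b (iY y′))
      ≈⟨ ⊕-cong (sumFinS-cong nX (κ·ĥκ°-summand-X x y)) (sumFinS-zero nY Y-summand) ⟩
    sumFinS nX (λ x′ → ifS (fibre x y x′) (scaleS (sign (iX x′) b) (κ a b))) ⊕ zeroS
      ≈⟨ (λ k → ℤ.+-identityʳ _) ⟩
    sumFinS nX (λ x′ → ifS (fibre x y x′) (scaleS (sign (iX x′) b) (κ a b)))
      ≈⟨ sumFinS-ifS-scaleS nX (fibre x y) (λ x′ → sign (iX x′) b) (κ a b) ⟩
    scaleS (sumFin nX (λ x′ → ifZ (fibre x y x′) (sign (iX x′) b))) (κ a b)
      ≈⟨ (λ k → trans (cong (_* κ a b k) (fibre-sign-sum x y σx≤y)) (ℤ.-1*i≡-i (κ a b k))) ⟩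
    negS (κ a b) ∎
    where
    open ≈ₛ-Reasoning
    a b : Fin N
    a = iX x
    b = iY y
    Y-summand : ∀ y′ → summand κ (ĥ κ°) a b (iY y′) ≈ₛ zeroS
    Y-summand y′ = ifS-zero (inInt Γ a (iY y′) b) (λ _ →
      ⊛-vanishesʳ (κ a (iY y′)) (ĥ-vanishes κ° (resXYo-Y- κ y′ b)))

  κ·ĥκ°≈-κ|XY : κ · ĥ κ° ≈ᴵ negI Γ κ|XY
  κ·ĥκ°≈-κ|XY a b a≤b with side a | side b
  ... | inX-side x refl | inY-side y  refl = ≈ₛ-trans (κ·ĥκ°-XY (iX≤iY⇒ a≤b)) (≈ₛ-sym (negS-cong (resXY-XY κ x y)))
  ... | inX-side x refl | inX-side x′ refl =
    ≈ₛ-trans (mul-vanishes κ (ĥ κ°) a b (λ w _ _ → ⊛-vanishesʳ (κ a w) (ĥ-vanishes κ° (resXYo--X κ w x′))))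
             (≈ₛ-sym (negS-cong (resXY-XX κ x x′)))
  ... | inY-side y refl | _ =
    ≈ₛ-trans (mul-vanishes κ (ĥ κ°) a b (λ w y≤w _ → above-y w y≤w))
             (≈ₛ-sym (negS-cong (resXY-Y- κ y b)))
    where
    above-y : ∀ w → iY y ≤Γ w → (κ a w ⊛ ĥ κ° w b) ≈ₛ zeroS
    above-y w y≤w with above-iY y≤w
    ... | y′ , refl = ⊛-vanishesʳ (κ a w) (ĥ-vanishes κ° (resXYo-Y- κ y′ b))

  κ|XY·ĥκ-summand-Y : ∀ x y y′ → summand κ|XY (ĥ κ) (iX x) (iY y) (iY y′)
                                  ≈ₛ ifS (inInt Y (σ x) y′ y) (scaleS (sgn (ρY y ∸ ρY y′)) (κ (iX x) (iY y)))
  κ|XY·ĥκ-summand-Y x y y′ rewrite inInt-XYY x y′ y = ifS-cong (inInt Y (σ x) y′ y) (λ y′∈ →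
    let (σx≤y′ , y′≤y) = Intervals.inInt⇒≤ Y y′∈ in begin
      κ|XY a c ⊛ ĥ κ c b                   ≈⟨ ⊛-congʳ (ĥ κ c b) (resXY-XY κ x y′) ⟩
      κ a c ⊛ scaleS (sign c b) (κ c b)    ≈⟨ ⊛-scaleSʳ (sign c b) (κ a c) (κ c b) ⟩
      scaleS (sign c b) (κ a c ⊛ κ c b)    ≈⟨ scaleS-cong (sign c b) (κ-mult a c b (iX≤iY⇐ σx≤y′) (iY≤iY⇐ y′≤y)) ⟨
      scaleS (sign c b) (κ a b)            ≈⟨ (λ k → cong (_* κ a b k) (sign-iY-iY y′ y)) ⟩
      scaleS (sgn (ρY y ∸ ρY y′)) (κ a b)  ∎)
    where
    open ≈ₛ-Reasoning
    a b : Fin N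
    a = iX x
    b = iY y
    c : Fin N
    c = iY y′

  -- Only y′ ∈ [σ x, y] contributes, with κ x y′ κ y′ y = κ x y, and the signs
  -- add up to [σ x = y] because Y is Eulerian.
  κ|XY·ĥκ-XY : ∀ {x y} → σ x Y.≤ y → (κ|XY · ĥ κ) (iX x) (iY y) ≈ₛ ifS (does (σ x Fin.≟ y)) (κ (iX x) (iY y))
  κ|XY·ĥκ-XY {x} {y} σx≤y = begin
    (κ|XY · ĥ κ) a b
      ≈⟨ sumFinS-Γ (summand κ|XY (ĥ κ) a b) ⟩
    sumFinS nX (λ x′ → summand κ|XY (ĥ κ) a b (iX x′)) ⊕ sumFinS nY (λ y′ → summand κ|XY (ĥ κ) a b (iY y′))
      ≈⟨ ⊕-cong (sumFinS-zero nX X-summand) (sumFinS-cong nY (κ|XY·ĥκ-summand-Y x y)) ⟩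
    zeroS ⊕ sumFinS nY (λ y′ → ifS (between y′) (scaleS (sgn (ρY y ∸ ρY y′)) (κ a b)))
      ≈⟨ (λ k → ℤ.+-identityˡ _) ⟩
    sumFinS nY (λ y′ → ifS (between y′) (scaleS (sgn (ρY y ∸ ρY y′)) (κ a b)))
      ≈⟨ sumFinS-ifS-scaleS nY between (λ y′ → sgn (ρY y ∸ ρY y′)) (κ a b) ⟩
    scaleS (sumFin nY (λ y′ → ifZ (between y′) (sgn (ρY y ∸ ρY y′)))) (κ a b)
      ≈⟨ (λ k → cong (_* κ a b k) (Y-signs-from-top (σ x) y σx≤y)) ⟩
    scaleS (ifZ (does (σ x Fin.≟ y)) 1ℤ) (κ a b)
      ≈⟨ indicator (does (σ x Fin.≟ y)) ⟩
    ifS (does (σ x Fin.≟ y)) (κ a b) ∎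
    where
    open ≈ₛ-Reasoning
    a b : Fin N
    a = iX x
    b = iY y
    between : Fin nY → Bool
    between y′ = inInt Y (σ x) y′ y
    X-summand : ∀ x′ → summand κ|XY (ĥ κ) a b (iX x′) ≈ₛ zeroS
    X-summand x′ = ifS-zero (inInt Γ a (iX x′) b) (λ _ → ⊛-vanishesˡ (ĥ κ (iX x′) b) (resXY-XX κ x x′))
    indicator : ∀ c → scaleS (ifZ c 1ℤ) (κ a b) ≈ₛ ifS c (κ a b)
    indicator true  k = ℤ.*-identityˡ (κ a b k)
    indicator false k = ℤ.*-zeroˡ (κ a b k)

  κ|XY·ĥκ≈κ° : κ|XY · ĥ κ ≈ᴵ κ°
  κ|XY·ĥκ≈κ° a b a≤b with side a | side b
  ... | inX-side x refl | inY-side y refl = ≈ₛ-trans (κ|XY·ĥκ-XY (iX≤iY⇒ a≤b)) (≈ₛ-sym (resXYo-XY κ x y))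
  ... | inX-side x refl | inX-side x′ refl =
    ≈ₛ-trans (mul-vanishes κ|XY (ĥ κ) a b (λ w _ w≤x′ → below-x′ w w≤x′)) (≈ₛ-sym (resXYo-XX κ x x′))
    where
    below-x′ : ∀ w → w ≤Γ iX x′ → (κ|XY a w ⊛ ĥ κ w b) ≈ₛ zeroS
    below-x′ w w≤x′ with below-iX w≤x′
    ... | x″ , refl = ⊛-vanishesˡ (ĥ κ w b) (resXY-XX κ x x″)
  ... | inY-side y refl | _ =
    ≈ₛ-trans (mul-vanishes κ|XY (ĥ κ) a b (λ w _ _ → ⊛-vanishesˡ (ĥ κ w b) (resXY-Y- κ y w)))
             (≈ₛ-sym (resXYo-Y- κ y b))

-- Kazhdan–Lusztig–Stanley functions

module KLS-Inverse
  (B : FinOrd) (B-po : IsPartialOrder _≡_ (FinOrd._≤_ B))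
  (r : Fin (FinOrd.size B) → Fin (FinOrd.size B) → ℕ) (r-weak : IsWeakRank B r)
  (ρ : Fin (FinOrd.size B) → ℕ) (ρ-mono : ∀ {z w} → FinOrd._≤_ B z w → ρ z ℕ.≤ ρ w)
  (κ : Inc B) (ĥκ·κ≈1 : EqI B (mul B (hat B ρ κ) κ) (oneI B))
  (f g : Inc B) (f-KLS : IsRightKLS B r κ f) (g-KLS : IsLeftKLS B r κ g)
  where

  open IncidenceAlgebra B B-po
  open Ranked r r-weak
  open Signed ρ ρ-mono

  f∈𝓘 : InCalI B r f
  f∈𝓘 = proj₁ (proj₁ f-KLS)

  g∈𝓘 : InCalI B r g
  g∈𝓘 = proj₁ (proj₁ g-KLS)

  f-rev : rev B r f ≈ᴵ κ · f
  f-rev = proj₂ (proj₂ f-KLS)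

  g-rev : rev B r g ≈ᴵ g · κ
  g-rev = proj₂ (proj₂ g-KLS)

  f-below-half : BelowHalfRank f
  f-below-half = BelowHalfRank-unit (proj₁ (proj₂ f-KLS)) (proj₂ (proj₁ f-KLS))

  ĝ-below-half : BelowHalfRank (ĥ g)
  ĝ-below-half = BelowHalfRank-unit (λ z → ≈ₛ-trans (ĥ-diag g z) (proj₁ (proj₂ g-KLS) z))
                   (λ z w z<w → Deg<½-scaleS (sign z w) (g z w) (proj₂ (proj₁ g-KLS) z w z<w))

  ĝ·f-palindromic : rev B r (ĥ g · f) ≈ᴵ ĥ g · f
  ĝ·f-palindromic = begin
    rev B r (ĥ g · f)                 ≈⟨ rev-· (InCalI-ĥ r g∈𝓘) f∈𝓘 ⟩
    rev B r (ĥ g) · rev B r f         ≈⟨ ·-cong (rev-ĥ r g) f-rev ⟩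
    ĥ (rev B r g) · (κ · f)           ≈⟨ ·-congʳ (κ · f) (ĥ-cong g-rev) ⟩
    ĥ (g · κ) · (κ · f)               ≈⟨ ·-congʳ (κ · f) (ĥ-· g κ) ⟩
    (ĥ g · ĥ κ) · (κ · f)             ≈⟨ ·-assoc (ĥ g) (ĥ κ) (κ · f) ⟩
    ĥ g · (ĥ κ · (κ · f))             ≈⟨ ·-congˡ (ĥ g) (·-assoc (ĥ κ) κ f) ⟨
    ĥ g · ((ĥ κ · κ) · f)             ≈⟨ ·-congˡ (ĥ g) (·-congʳ f ĥκ·κ≈1) ⟩
    ĥ g · (oneI B · f)                ≈⟨ ·-congˡ (ĥ g) (·-identityˡ f) ⟩
    ĥ g · f                           ∎
    where open ≈ᴵ-Reasoning

  -- ĝ · f is palindromic, and below half rank off the diagonal, hence trivial.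
  ĝ·f≈1 : ĥ g · f ≈ᴵ oneI B
  ĝ·f≈1 z z′ z≤z′ with z Fin.≟ z′
  ... | yes refl = ≈ₛ-trans (mul-diag (ĥ g) f z)
                     (≈ₛ-trans (⊛-cong (≈ₛ-trans (ĥ-diag g z) (proj₁ (proj₂ g-KLS) z)) (proj₁ (proj₂ f-KLS) z))
                               (⊛-identityˡ oneS))
  ... | no z≢z′ = palindromic-Deg<½⇒zero (r z z′) ((ĥ g · f) z z′)
                    (Deg<½-· ĝ-below-half f-below-half z z′ (z≤z′ , z≢z′)) (ĝ·f-palindromic z z′ z≤z′)

  module _ (g⁻¹ : Inc B) (g⁻¹·g≈1 : g⁻¹ · g ≈ᴵ oneI B) where

    ĝ⁻¹≈f : ĥ g⁻¹ ≈ᴵ f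
    ĝ⁻¹≈f = begin
      ĥ g⁻¹                   ≈⟨ ·-identityʳ (ĥ g⁻¹) ⟨
      ĥ g⁻¹ · oneI B          ≈⟨ ·-congˡ (ĥ g⁻¹) ĝ·f≈1 ⟨
      ĥ g⁻¹ · (ĥ g · f)       ≈⟨ ·-assoc (ĥ g⁻¹) (ĥ g) f ⟨
      (ĥ g⁻¹ · ĥ g) · f       ≈⟨ ·-congʳ f (ĥ-· g⁻¹ g) ⟨
      ĥ (g⁻¹ · g) · f         ≈⟨ ·-congʳ f (ĥ-cong g⁻¹·g≈1) ⟩
      ĥ (oneI B) · f          ≈⟨ ·-congʳ f ĥ-oneI ⟩
      oneI B · f              ≈⟨ ·-identityˡ f ⟩
      f                       ∎
      where open ≈ᴵ-Reasoning

    g⁻¹≈f̂ : g⁻¹ ≈ᴵ ĥ f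
    g⁻¹≈f̂ = ≈ᴵ-trans (≈ᴵ-sym (ĥ-involutive g⁻¹)) (ĥ-cong ĝ⁻¹≈f)

    f·ĝ≈1 : f · ĥ g ≈ᴵ oneI B
    f·ĝ≈1 = begin
      f · ĥ g                 ≈⟨ ·-congʳ (ĥ g) ĝ⁻¹≈f ⟨
      ĥ g⁻¹ · ĥ g             ≈⟨ ĥ-· g⁻¹ g ⟨
      ĥ (g⁻¹ · g)             ≈⟨ ĥ-cong g⁻¹·g≈1 ⟩
      ĥ (oneI B)              ≈⟨ ĥ-oneI ⟩
      oneI B                  ∎
      where open ≈ᴵ-Reasoning

module Subdivision
  (X Y : FinOrd) (ρX : Fin (FinOrd.size X) → ℕ) (ρY : Fin (FinOrd.size Y) → ℕ)
  (X-eulerian : IsLowerEulerian X ρX) (Y-eulerian : IsLowerEulerian Y ρY)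
  (σ : Fin (FinOrd.size X) → Fin (FinOrd.size Y))
  (σ-subdivision : IsStrongFormalSubdivision X Y ρX ρY σ)
  (r : Elt (Gam X Y σ) → Elt (Gam X Y σ) → ℕ) (r-weak : IsWeakRank (Gam X Y σ) r)
  (κ : Inc (Gam X Y σ)) (κ∈𝓘 : InCalI (Gam X Y σ) r κ) (κ-unit : InU (Gam X Y σ) r κ)
  (κ-mult : Multiplicative (Gam X Y σ) κ)
  (κ-alt : RankAlternating (Gam X Y σ) r (ρGam X Y σ ρX ρY) κ)
  (f g : Inc (Gam X Y σ)) (f-KLS : IsRightKLS (Gam X Y σ) r κ f) (g-KLS : IsLeftKLS (Gam X Y σ) r κ g)
  (g⁻¹ : Inc (Gam X Y σ)) (g⁻¹·g≈1 : EqI (Gam X Y σ) (mul (Gam X Y σ) g⁻¹ g) (oneI (Gam X Y σ)))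
  (h : Inc (Gam X Y σ))
  (h-def : EqI (Gam X Y σ) (λ a b → tMinus1 ⊛ h a b) (mul (Gam X Y σ) g (resXYo X Y σ κ)))
  (ℓ : Inc (Gam X Y σ)) (ℓ-def : EqI (Gam X Y σ) ℓ (mul (Gam X Y σ) h g⁻¹))
  where

  open Kernel X Y ρX ρY X-eulerian Y-eulerian σ σ-subdivision r r-weak κ κ∈𝓘 κ-unit κ-mult κ-alt public
  open KLS-Inverse Γ Γ-isPartialOrder r r-weak ρΓ ρΓ-mono κ ĥκ·κ≈1 f g f-KLS g-KLS

  M : Inc Γ
  M = g · κ° · ĥ f

  M∈𝓘 : InCalI Γ r M
  M∈𝓘 = InCalI-· (InCalI-· g∈𝓘 κ°∈𝓘) (InCalI-ĥ r f∈𝓘)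

  [t-1]ℓ≈M : (λ a b → tMinus1 ⊛ ℓ a b) ≈ᴵ M
  [t-1]ℓ≈M = begin
    (λ a b → tMinus1 ⊛ ℓ a b)               ≈⟨ (λ a b a≤b → ⊛-congˡ tMinus1 (ℓ-def a b a≤b)) ⟩
    (λ a b → tMinus1 ⊛ (h · g⁻¹) a b)       ≈⟨ ≈ᴵ-pointwise (⊛-·ˡ tMinus1 h g⁻¹) ⟩
    (λ a b → tMinus1 ⊛ h a b) · g⁻¹         ≈⟨ ·-cong h-def (g⁻¹≈f̂ g⁻¹ g⁻¹·g≈1) ⟩
    g · κ° · ĥ f                            ∎
    where open ≈ᴵ-Reasoning

  M-antipalindromic : rev Γ r M ≈ᴵ negI Γ M
  M-antipalindromic = begin
    rev Γ r (g · κ° · ĥ f)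
      ≈⟨ rev-· (InCalI-· g∈𝓘 κ°∈𝓘) (InCalI-ĥ r f∈𝓘) ⟩
    rev Γ r (g · κ°) · rev Γ r (ĥ f)
      ≈⟨ ·-cong (rev-· g∈𝓘 κ°∈𝓘) (rev-ĥ r f) ⟩
    rev Γ r g · rev Γ r κ° · ĥ (rev Γ r f)
      ≈⟨ ·-cong (·-cong g-rev rev-κ°) (ĥ-cong f-rev) ⟩
    g · κ · ĥ κ° · ĥ (κ · f)
      ≈⟨ ·-cong (·-assoc g κ (ĥ κ°)) (ĥ-· κ f) ⟩
    g · (κ · ĥ κ°) · (ĥ κ · ĥ f)
      ≈⟨ ·-congʳ (ĥ κ · ĥ f) (·-congˡ g κ·ĥκ°≈-κ|XY) ⟩
    g · negI Γ κ|XY · (ĥ κ · ĥ f)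
      ≈⟨ ·-congʳ (ĥ κ · ĥ f) (≈ᴵ-pointwise (·-negIʳ g κ|XY)) ⟩
    negI Γ (g · κ|XY) · (ĥ κ · ĥ f)
      ≈⟨ ≈ᴵ-pointwise (·-negIˡ (g · κ|XY) (ĥ κ · ĥ f)) ⟩
    negI Γ (g · κ|XY · (ĥ κ · ĥ f))
      ≈⟨ negI-cong (·-assoc (g · κ|XY) (ĥ κ) (ĥ f)) ⟨
    negI Γ (g · κ|XY · ĥ κ · ĥ f)
      ≈⟨ negI-cong (·-congʳ (ĥ f) (·-assoc g κ|XY (ĥ κ))) ⟩
    negI Γ (g · (κ|XY · ĥ κ) · ĥ f)
      ≈⟨ negI-cong (·-congʳ (ĥ f) (·-congˡ g κ|XY·ĥκ≈κ°)) ⟩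
    negI Γ (g · κ° · ĥ f) ∎
    where open ≈ᴵ-Reasoning

  Q : Inc Γ
  Q = negI Γ (ĥ M)

  D : Inc Γ
  D = Δ Γ r (ĥ ℓ)

  [t-1]ĥℓ≈-Q : ∀ a b → a ≤Γ b → (tMinus1 ⊛ ĥ ℓ a b) ≈ₛ negS (Q a b)
  [t-1]ĥℓ≈-Q a b a≤b = ≈ₛ-trans (⊛-scaleSʳ (sign a b) tMinus1 (ℓ a b))
    (≈ₛ-trans (scaleS-cong (sign a b) ([t-1]ℓ≈M a b a≤b)) (≈ₛ-sym (negS-involutive (ĥ M a b))))

  M-diag : ∀ a → M a a ≈ₛ zeroS
  M-diag a = ≈ₛ-trans (mul-diag (g · κ°) (ĥ f) a)
    (⊛-vanishesˡ (ĥ f a a) (≈ₛ-trans (mul-diag g κ° a) (⊛-vanishesʳ (g a a) (κ°-diag a))))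

  Q-vanishes-with-M : ∀ {a b} → M a b ≈ₛ zeroS → Q a b ≈ₛ zeroS
  Q-vanishes-with-M M≈0 = negS-cong (ĥ-vanishes M M≈0)

  Q∈𝓘 : InCalI Γ r Q
  Q∈𝓘 a b a≤b i r<i = cong -_ (InCalI-ĥ r M∈𝓘 a b a≤b i r<i)

  Q-antipalindromic : rev Γ r Q ≈ᴵ negI Γ Q
  Q-antipalindromic a b a≤b k = begin
    revS (r a b) (negS (ĥ M a b)) k          ≡⟨ revS-negS (r a b) (ĥ M a b) k ⟩
    - revS (r a b) (ĥ M a b) k               ≡⟨ cong -_ (revS-scaleS (r a b) (sign a b) (M a b) k) ⟩
    - (sign a b * revS (r a b) (M a b) k)    ≡⟨ cong (λ u → - (sign a b * u)) (M-antipalindromic a b a≤b k) ⟩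
    - (sign a b * - M a b k)                 ≡⟨ cong -_ (ℤ.neg-distribʳ-* (sign a b) (M a b k)) ⟨
    - - (sign a b * M a b k)                 ∎
    where open ≡-Reasoning

  rev-D : rev Γ r D ≈ᴵ addI D (negI Γ Q)
  rev-D = rev-Δ (ĥ ℓ) Q [t-1]ĥℓ≈-Q Q∈𝓘 Q-antipalindromic (λ a → Q-vanishes-with-M (M-diag a))

  M-from-Y : ∀ {y b} → iY y ≤Γ b → M (iY y) b ≈ₛ zeroS
  M-from-Y {y} {b} _ = mul-vanishes (g · κ°) (ĥ f) (iY y) b (λ w _ _ →
    ⊛-vanishesˡ (ĥ f w b) (mul-vanishes g κ° (iY y) w (λ u y≤u _ → g·κ°-term u y≤u)))
    where
    g·κ°-term : ∀ {w} u → iY y ≤Γ u → (g (iY y) u ⊛ κ° u w) ≈ₛ zeroS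
    g·κ°-term {w} u y≤u with above-iY y≤u
    ... | y′ , refl = ⊛-vanishesʳ (g (iY y) (iY y′)) (resXYo-Y- κ y′ w)

  M-to-X : ∀ {a x} → a ≤Γ iX x → M a (iX x) ≈ₛ zeroS
  M-to-X {a} {x} _ = mul-vanishes (g · κ°) (ĥ f) a (iX x) (λ w _ w≤x → term w w≤x)
    where
    term : ∀ w → w ≤Γ iX x → ((g · κ°) a w ⊛ ĥ f w (iX x)) ≈ₛ zeroS
    term w w≤x with below-iX w≤x
    ... | x′ , refl = ⊛-vanishesˡ (ĥ f (iX x′) (iX x))
      (mul-vanishes g κ° a (iX x′) (λ u _ _ → ⊛-vanishesʳ (g a u) (resXYo--X κ u x′)))

  D-vanishes-with-M : ∀ {a b} → a ≤Γ b → M a b ≈ₛ zeroS → D a b ≈ₛ zeroS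
  D-vanishes-with-M {a} {b} a≤b M≈0 = by-cases (a Fin.≟ b)
    where
    by-cases : Dec (a ≡ b) → D a b ≈ₛ zeroS
    by-cases (yes refl) = Δ-diag (ĥ ℓ) a
    by-cases (no a≢b)   = ≈ₛ-trans (Δ≈lowerHalf (ĥ ℓ) (Q a b) (a≤b , a≢b) ([t-1]ĥℓ≈-Q a b a≤b))
                                   (lowerHalf-zero (r a b) (Q-vanishes-with-M M≈0))

  f·D-from-Y : ∀ {y b} → iY y ≤Γ b → (f · D) (iY y) b ≈ₛ zeroS
  f·D-from-Y {y} {b} _ = mul-vanishes f D (iY y) b (λ w y≤w w≤b →
    ⊛-vanishesʳ (f (iY y) w) (D-vanishes-with-M w≤b (M-from-Y′ y≤w w≤b)))
    where
    M-from-Y′ : ∀ {w} → iY y ≤Γ w → w ≤Γ b → M w b ≈ₛ zeroS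
    M-from-Y′ y≤w w≤b with above-iY y≤w
    ... | y′ , refl = M-from-Y w≤b

  f·D-to-X : ∀ {a x} → a ≤Γ iX x → (f · D) a (iX x) ≈ₛ zeroS
  f·D-to-X {a} {x} _ = mul-vanishes f D a (iX x) (λ w _ w≤x →
    ⊛-vanishesʳ (f a w) (D-vanishes-with-M w≤x (M-to-X w≤x)))

  κ·f·Q≈κ|XY·f : κ · f · Q ≈ᴵ κ|XY · f
  κ·f·Q≈κ|XY·f = begin
    κ · f · negI Γ (ĥ M)                 ≈⟨ ≈ᴵ-pointwise (·-negIʳ (κ · f) (ĥ M)) ⟩
    negI Γ (κ · f · ĥ M)                 ≈⟨ negI-cong (·-congˡ (κ · f) ĥM≈ĝ·ĥκ°·f) ⟩
    negI Γ (κ · f · (ĥ g · ĥ κ° · f))    ≈⟨ negI-cong (·-congˡ (κ · f) (·-assoc (ĥ g) (ĥ κ°) f)) ⟩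
    negI Γ (κ · f · (ĥ g · (ĥ κ° · f)))  ≈⟨ negI-cong (·-assoc κ f (ĥ g · (ĥ κ° · f))) ⟩
    negI Γ (κ · (f · (ĥ g · (ĥ κ° · f)))) ≈⟨ negI-cong (·-congˡ κ (·-assoc f (ĥ g) (ĥ κ° · f))) ⟨
    negI Γ (κ · (f · ĥ g · (ĥ κ° · f)))  ≈⟨ negI-cong (·-congˡ κ (·-congʳ (ĥ κ° · f) (f·ĝ≈1 g⁻¹ g⁻¹·g≈1))) ⟩
    negI Γ (κ · (oneI Γ · (ĥ κ° · f)))   ≈⟨ negI-cong (·-congˡ κ (·-identityˡ (ĥ κ° · f))) ⟩
    negI Γ (κ · (ĥ κ° · f))              ≈⟨ negI-cong (·-assoc κ (ĥ κ°) f) ⟨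
    negI Γ (κ · ĥ κ° · f)                ≈⟨ negI-cong (·-congʳ f κ·ĥκ°≈-κ|XY) ⟩
    negI Γ (negI Γ κ|XY · f)             ≈⟨ negI-cong (≈ᴵ-pointwise (·-negIˡ κ|XY f)) ⟩
    negI Γ (negI Γ (κ|XY · f))           ≈⟨ ≈ᴵ-pointwise (λ a b → negS-involutive ((κ|XY · f) a b)) ⟩
    κ|XY · f                             ∎
    where
    open ≈ᴵ-Reasoning
    ĥM≈ĝ·ĥκ°·f : ĥ M ≈ᴵ ĥ g · ĥ κ° · f
    ĥM≈ĝ·ĥκ°·f = begin
      ĥ (g · κ° · ĥ f)        ≈⟨ ĥ-· (g · κ°) (ĥ f) ⟩
      ĥ (g · κ°) · ĥ (ĥ f)    ≈⟨ ·-cong (ĥ-· g κ°) (ĥ-involutive f) ⟩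
      ĥ g · ĥ κ° · f          ∎

  G : Inc Γ
  G = addI f (f · D)

  rev-G : ∀ a b → a ≤Γ b → rev Γ r G a b ≈ₛ ((κ · G) a b ⊕ negS ((κ|XY · f) a b))
  rev-G a b a≤b = begin
    revS (r a b) (f a b ⊕ (f · D) a b)
      ≈⟨ revS-⊕ (r a b) (f a b) ((f · D) a b) ⟩
    rev Γ r f a b ⊕ rev Γ r (f · D) a b
      ≈⟨ ⊕-cong (f-rev a b a≤b) (rev-· f∈𝓘 (Δ∈𝓘 (ĥ ℓ) Q [t-1]ĥℓ≈-Q) a b a≤b) ⟩
    (κ · f) a b ⊕ (rev Γ r f · rev Γ r D) a b
      ≈⟨ ⊕-cong (≈ₛ-refl {(κ · f) a b}) (·-cong f-rev rev-D a b a≤b) ⟩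
    (κ · f) a b ⊕ (κ · f · addI D (negI Γ Q)) a b
      ≈⟨ ⊕-cong (≈ₛ-refl {(κ · f) a b}) (·-distribˡ-addI (κ · f) D (negI Γ Q) a b) ⟩
    (κ · f) a b ⊕ ((κ · f · D) a b ⊕ (κ · f · negI Γ Q) a b)
      ≈⟨ ⊕-cong (≈ₛ-refl {(κ · f) a b}) (⊕-cong (·-assoc κ f D a b a≤b)
                  (≈ₛ-trans (·-negIʳ (κ · f) Q a b) (negS-cong (κ·f·Q≈κ|XY·f a b a≤b)))) ⟩
    (κ · f) a b ⊕ ((κ · (f · D)) a b ⊕ negS ((κ|XY · f) a b))
      ≈⟨ (λ k → sym (ℤ.+-assoc ((κ · f) a b k) _ _)) ⟩
    ((κ · f) a b ⊕ (κ · (f · D)) a b) ⊕ negS ((κ|XY · f) a b)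
      ≈⟨ ⊕-cong (≈ₛ-sym (·-distribˡ-addI κ f (f · D) a b)) (≈ₛ-refl {negS ((κ|XY · f) a b)}) ⟩
    (κ · G) a b ⊕ negS ((κ|XY · f) a b) ∎
    where open ≈ₛ-Reasoning

  -- By rev-G, G x y = Σ_w κ x w G w y - κ|XY x w f w y. The terms w = iX x′ ≠ x
  -- vanish by hypothesis, those w = iY y′ cancel because f · D vanishes on
  -- intervals starting in Y, and w = x leaves G x y. So G x y is palindromic and
  -- of degree below r(x, y) / 2.
  G-XY-step : ∀ {x y} → iX x ≤Γ iY y →
              (∀ {x′} → x′ ≢ x → iX x ≤Γ iX x′ → iX x′ ≤Γ iY y → G (iX x′) (iY y) ≈ₛ zeroS) →
              G (iX x) (iY y) ≈ₛ zeroS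
  G-XY-step {x} {y} x≤y G-above-x = palindromic-Deg<½⇒zero (r a b) (G a b) G-below-half G-palindromic
    where
    a b : Fin N
    a = iX x
    b = iY y
    a<b : _<_ Γ a b
    a<b = x≤y , iX≢iY x y
    G-below-half : Deg<½ (r a b) (G a b)
    G-below-half = Deg<½-⊕ (proj₂ (proj₁ f-KLS) a b a<b)
                           (Deg<½-· f-below-half (Δ-below-half (ĥ ℓ) Q [t-1]ĥℓ≈-Q) a b a<b)
    term : Fin N → Series
    term w = ifS (inInt Γ a w b) ((κ a w ⊛ G w b) ⊕ negS (κ|XY a w ⊛ f w b))
    term-off-a : ∀ w → w ≢ a → term w ≈ₛ zeroS
    term-off-a w w≢a = ifS-zero (inInt Γ a w b) (λ w∈ → by-side w w≢a (proj₁ (inInt⇒≤ w∈)) (proj₂ (inInt⇒≤ w∈)))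
      where
      by-side : ∀ w → w ≢ a → a ≤Γ w → w ≤Γ b → ((κ a w ⊛ G w b) ⊕ negS (κ|XY a w ⊛ f w b)) ≈ₛ zeroS
      by-side w w≢a a≤w w≤b with side w
      ... | inX-side x′ refl = ⊕-cong (⊛-vanishesʳ (κ a w) (G-above-x (w≢a ∘ cong iX) a≤w w≤b))
                                      (negS-cong (⊛-vanishesˡ (f w b) (resXY-XX κ x x′)))
      ... | inY-side y′ refl = λ k → trans
          (cong₂ (λ u v → u + - v) (⊛-congˡ (κ a w) G≈f k) (⊛-congʳ (f w b) (resXY-XY κ x y′) k))
          (ℤ.+-inverseʳ ((κ a w ⊛ f w b) k))
        where
        G≈f : G w b ≈ₛ f w b
        G≈f k = trans (cong (f w b k +_) (f·D-from-Y w≤b k)) (ℤ.+-identityʳ _)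
    term-at-a : term a ≈ₛ G a b
    term-at-a = ≈ₛ-trans (ifS-true _ (inInt-true ≤Γ.refl x≤y))
      (λ k → trans (cong₂ (λ u v → u + - v) (≈ₛ-trans (⊛-congʳ (G a b) (κ-unit a)) (⊛-identityˡ (G a b)) k)
                                              (⊛-vanishesˡ (f a b) (resXY-XX κ x x) k))
                   (ℤ.+-identityʳ _))
    G-palindromic : revS (r a b) (G a b) ≈ₛ G a b
    G-palindromic = ≈ₛ-trans (rev-G a b x≤y)
      (≈ₛ-trans (·-difference κ G κ|XY f a b) (≈ₛ-trans (sumFinS-select N term a term-off-a) term-at-a))

  G-XY : ∀ n {x y} → iX x ≤Γ iY y → r (iX x) (iY y) ℕ.≤ n → G (iX x) (iY y) ≈ₛ zeroS
  G-XY zero    {x} {y} x≤y r≤0 = ⊥-elim (ℕ.<⇒≱ (r-pos (x≤y , iX≢iY x y)) r≤0)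
  G-XY (suc n) {x} {y} x≤y r≤1+n = G-XY-step x≤y (λ {x′} x′≢x x≤x′ x′≤y →
    G-XY n x′≤y (ℕ.s≤s⁻¹ (ℕ.≤-trans (ℕ.+-monoˡ-≤ _ (r-pos (x≤x′ , x′≢x ∘ sym ∘ Fin.↑ˡ-injective nY x x′)))
                                   (subst (ℕ._≤ suc n) (r-additive x≤x′ x′≤y) r≤1+n))))

  f-XY : ∀ {x y} → iX x ≤Γ iY y → f (iX x) (iY y) ≈ₛ negS ((f · D) (iX x) (iY y))
  f-XY {x} {y} x≤y k = inverseˡ-unique (f (iX x) (iY y) k) ((f · D) (iX x) (iY y) k) (G-XY _ x≤y ℕ.≤-refl k)
    where open GroupProperties (AbelianGroup.group ℤ.+-0-abelianGroup) using (inverseˡ-unique)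

  f|XY≈-f·D : resXY X Y σ f ≈ᴵ negI Γ (f · D)
  f|XY≈-f·D a b a≤b with side a | side b
  ... | inX-side x refl | inX-side x′ refl = ≈ₛ-trans (resXY-XX f x x′) (≈ₛ-sym (negS-cong (f·D-to-X a≤b)))
  ... | inX-side x refl | inY-side y  refl = ≈ₛ-trans (resXY-XY f x y) (f-XY a≤b)
  ... | inY-side y refl | _               = ≈ₛ-trans (resXY-Y- f y b) (≈ₛ-sym (negS-cong (f·D-from-Y a≤b)))

  f·D≈f|X·D : f · D ≈ᴵ resX X Y σ f · D
  f·D≈f|X·D a b _ = mul-pointwise {f} {D} {resX X Y σ f} {D} a b term
    where
    term : ∀ w → a ≤Γ w → w ≤Γ b → (f a w ⊛ D w b) ≈ₛ (resX X Y σ f a w ⊛ D w b)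
    term w a≤w w≤b with side a | side w
    ... | inY-side y refl | inX-side x′ refl = ⊥-elim (iY≰iX a≤w)
    ... | inX-side x refl | inX-side x′ refl = ⊛-congʳ (D w b) (≈ₛ-sym (resX-XX f x x′))
    ... | _               | inY-side y′ refl =
      ≈ₛ-trans (⊛-vanishesʳ (f a w) D≈0) (≈ₛ-sym (⊛-vanishesʳ (resX X Y σ f a w) D≈0))
      where
      D≈0 : D w b ≈ₛ zeroS
      D≈0 = D-vanishes-with-M w≤b (M-from-Y w≤b)

  D-XY : ∀ {x′ y} → σ x′ Y.≤ y → D (iX x′) (iY y) ≈ₛ negS (scaleS (sgn (ρY y ∸ ρX x′)) (Δ Γ r ℓ (iX x′) (iY y)))
  D-XY {x′} {y} σx′≤y k = trans (Δ-ĥ r ℓ (iX x′) (iY y) k)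
    (trans (cong (_* Δ Γ r ℓ (iX x′) (iY y) k) (sign-iX-iY (ℕ.≤-trans (ρX≤ρYσ x′) (ρY-mono σx′≤y))))
           (sym (ℤ.neg-distribˡ-* (sgn (ρY y ∸ ρX x′)) (Δ Γ r ℓ (iX x′) (iY y) k))))

  f·D-summand-X : ∀ x y x′ → negS (summand f D (iX x) (iY y) (iX x′)) ≈ₛ
    (if does (x X.≤? x′) ∧ does (σ x′ Y.≤? y)
     then scaleS (sgn (ρY y ∸ ρX x′)) (f (iX x) (iX x′) ⊛ Δ Γ r ℓ (iX x′) (iY y))
     else zeroS)
  f·D-summand-X x y x′ rewrite inInt-XXY x x′ y with x X.≤? x′ | σ x′ Y.≤? y
  ... | no _  | _     = ≈ₛ-refl
  ... | yes _ | no _  = ≈ₛ-refl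
  ... | yes _ | yes σx′≤y = begin
    negS (fxx′ ⊛ D (iX x′) (iY y))              ≈⟨ negS-cong (⊛-congˡ fxx′ (D-XY σx′≤y)) ⟩
    negS (fxx′ ⊛ negS (scaleS s Δℓ))            ≈⟨ negS-cong (⊛-negS fxx′ (scaleS s Δℓ)) ⟩
    negS (negS (fxx′ ⊛ scaleS s Δℓ))            ≈⟨ negS-involutive (fxx′ ⊛ scaleS s Δℓ) ⟩
    fxx′ ⊛ scaleS s Δℓ                          ≈⟨ ⊛-scaleSʳ s fxx′ Δℓ ⟩
    scaleS s (fxx′ ⊛ Δℓ)                        ∎
    where
    open ≈ₛ-Reasoning
    s : ℤ
    s = sgn (ρY y ∸ ρX x′)
    fxx′ Δℓ : Series
    fxx′ = f (iX x) (iX x′)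
    Δℓ = Δ Γ r ℓ (iX x′) (iY y)

  f-XY-expansion : ∀ x y → σ x Y.≤ y →
    f (iX x) (iY y) ≈ₛ sumFinS nX (λ x′ →
      if does (x X.≤? x′) ∧ does (σ x′ Y.≤? y)
      then scaleS (sgn (ρY y ∸ ρX x′)) (f (iX x) (iX x′) ⊛ Δ Γ r ℓ (iX x′) (iY y))
      else zeroS)
  f-XY-expansion x y σx≤y = begin
    f a b
      ≈⟨ f-XY (iX≤iY⇐ σx≤y) ⟩
    negS ((f · D) a b)
      ≈⟨ negS-cong (sumFinS-Γ (summand f D a b)) ⟩
    negS (sumFinS nX (λ x′ → summand f D a b (iX x′)) ⊕ sumFinS nY (λ y′ → summand f D a b (iY y′)))
      ≈⟨ negS-cong (⊕-cong (≈ₛ-refl {sumFinS nX (λ x′ → summand f D a b (iX x′))}) (sumFinS-zero nY Y-summand)) ⟩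
    negS (sumFinS nX (λ x′ → summand f D a b (iX x′)) ⊕ zeroS)
      ≈⟨ (λ k → cong -_ (ℤ.+-identityʳ _)) ⟩
    negS (sumFinS nX (λ x′ → summand f D a b (iX x′)))
      ≈⟨ sumFinS-negS nX (λ x′ → summand f D a b (iX x′)) ⟨
    sumFinS nX (λ x′ → negS (summand f D a b (iX x′)))
      ≈⟨ sumFinS-cong nX (f·D-summand-X x y) ⟩
    _ ∎
    where
    open ≈ₛ-Reasoning
    a b : Fin N
    a = iX x
    b = iY y
    Y-summand : ∀ y′ → summand f D a b (iY y′) ≈ₛ zeroS
    Y-summand y′ = ifS-zero (inInt Γ a (iY y′) b) (λ y′∈ →
      ⊛-vanishesʳ (f a (iY y′)) (D-vanishes-with-M (proj₂ (inInt⇒≤ y′∈)) (M-from-Y (proj₂ (inInt⇒≤ y′∈)))))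

corollary3p13 :
  (X Y : FinOrd)
  (ρX : Fin (FinOrd.size X) → ℕ) (ρY : Fin (FinOrd.size Y) → ℕ) →
  IsLowerEulerian X ρX → IsLowerEulerian Y ρY →
  (σ : Fin (FinOrd.size X) → Fin (FinOrd.size Y)) →
  IsStrongFormalSubdivision X Y ρX ρY σ →
  let Γ = Gam X Y σ
      ρΓ = ρGam X Y σ ρX ρY
  in
  (r : Elt Γ → Elt Γ → ℕ) → IsWeakRank Γ r →
  (κ : Inc Γ) → InCalI Γ r κ → InU Γ r κ →
  Multiplicative Γ κ → RankAlternating Γ r ρΓ κ →
  (f g : Inc Γ) → IsRightKLS Γ r κ f → IsLeftKLS Γ r κ g →
  (ginv : Inc Γ) → EqI Γ (mul Γ g ginv) (oneI Γ) → EqI Γ (mul Γ ginv g) (oneI Γ) →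
  (h : Inc Γ) →
  EqI Γ (λ a b → tMinus1 ⊛ h a b) (mul Γ g (resXYo X Y σ κ)) →
  (ℓ : Inc Γ) → EqI Γ ℓ (mul Γ h ginv) →
  let D = Δ Γ r (hat Γ ρΓ ℓ) in
  EqI Γ (resXY X Y σ f) (negI Γ (mul Γ f D)) ×
  EqI Γ (negI Γ (mul Γ f D)) (negI Γ (mul Γ (resX X Y σ f) D)) ×
  (∀ x y → FinOrd._≤_ Y (σ x) y →
    f (inX X Y σ x) (inY X Y σ y) ≈ₛ
    sumFinS (FinOrd.size X) (λ x' →
      if does (FinOrd._≤?_ X x x') ∧ does (FinOrd._≤?_ Y (σ x') y)
      then scaleS (sgn (ρY y ∸ ρX x'))
             (f (inX X Y σ x) (inX X Y σ x') ⊛ Δ Γ r ℓ (inX X Y σ x') (inY X Y σ y))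
      else zeroS))
corollary3p13 X Y ρX ρY X-eulerian Y-eulerian σ σ-subdivision r r-weak κ κ∈𝓘 κ-unit κ-mult κ-alt
              f g f-KLS g-KLS g⁻¹ _ g⁻¹·g≈1 h h-def ℓ ℓ-def =
  f|XY≈-f·D , negI-cong f·D≈f|X·D , f-XY-expansion
  where
  open Subdivision X Y ρX ρY X-eulerian Y-eulerian σ σ-subdivision r r-weak κ κ∈𝓘 κ-unit κ-mult κ-alt
                   f g f-KLS g-KLS g⁻¹ g⁻¹·g≈1 h h-def ℓ ℓ-def
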